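{- Let $m\geq 1$ and let $T$ be a tree on $2m$ vertices with matching number $m$. Then $M_1(T)\leq m^2+5m-4$, with equality if and only if $T\cong T_{2m,m}$.
   Context: For a graph $G$, $M_1(G)=\sum_{uv\in E(G)}(d_G(u)+d_G(v))$, where $d_G$ is the degree. $T_{n,m}$ denotes the tree obtained from the star $K_{1,n-m}$ by attaching a new pendent vertex to each of $m-1$ of its pendent vertices; in particular $T_{2m,m}$ is obtained from $K_{1,m}$ by attaching a new pendent vertex to each of $m-1$ of its leaves. -}

module Defs where

open import Data.Nat using (ℕ; zero; suc; _+_; _*_; _∸_; _≤_; _<_; _≤ᵇ_; _<ᵇ_; _≡ᵇ_)
open import Data.Bool using (Bool; true; false; _∧_; _∨_; not; if_then_else_)
open import Data.Bool.Properties using (∨-comm)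
open import Data.Fin using (Fin; toℕ)
open import Data.List using (List; []; _∷_; length; _++_)
open import Data.List.Relation.Unary.Unique.Propositional using (Unique)
open import Data.List.Relation.Unary.All using (All)
open import Data.Product using (_×_; Σ; _,_; proj₁; proj₂)
open import Function.Bundles using (_↔_; Inverse)
open import Relation.Binary.PropositionalEquality using (_≡_; refl)

record Graph (n : ℕ) : Set where
  field
    adj    : Fin n → Fin n → Bool
    sym    : ∀ u v → adj u v ≡ adj v u
    irrefl : ∀ u → adj u u ≡ false
open Graph public

sumFin : {n : ℕ} → (Fin n → ℕ) → ℕ
sumFin {zero}  f = 0
sumFin {suc n} f = f Fin.zero + sumFin (λ i → f (Fin.suc i))

b2n : Bool → ℕ
b2n true  = 1
b2n false = 0

degree : {n : ℕ} → Graph n → Fin n → ℕ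
degree G u = sumFin (λ v → b2n (adj G u v))

-- First Zagreb index:  M₁(G) = Σ_{uv ∈ E(G)} (d(u) + d(v)),
-- each edge counted once via the pair u < v.
M₁ : {n : ℕ} → Graph n → ℕ
M₁ G = sumFin (λ u → sumFin (λ v →
         if (toℕ u <ᵇ toℕ v) ∧ adj G u v then degree G u + degree G v else 0))

data Walk {n : ℕ} (G : Graph n) : Fin n → Fin n → Set where
  here : ∀ {u} → Walk G u u
  step : ∀ {u v w} → adj G u v ≡ true → Walk G v w → Walk G u w

Connected : {n : ℕ} → Graph n → Set
Connected G = ∀ u v → Walk G u v

Chain : {n : ℕ} → Graph n → List (Fin n) → Set
Chain G []           = Data.Unit.⊤ where import Data.Unit
Chain G (x ∷ [])     = Data.Unit.⊤ where import Data.Unit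
Chain G (x ∷ y ∷ xs) = (adj G x y ≡ true) × Chain G (y ∷ xs)

last : {A : Set} → A → List A → A
last a []       = a
last a (x ∷ xs) = last x xs

record Cycle {n : ℕ} (G : Graph n) : Set where
  field
    v₀ v₁ v₂ : Fin n
    rest     : List (Fin n)
    distinct : Unique (v₀ ∷ v₁ ∷ v₂ ∷ rest)
    chain    : Chain G (v₀ ∷ v₁ ∷ v₂ ∷ rest)
    closing  : adj G (last v₂ rest) v₀ ≡ true

Acyclic : {n : ℕ} → Graph n → Set
Acyclic G = Cycle G → Data.Empty.⊥ where import Data.Empty

IsTree : {n : ℕ} → Graph n → Set
IsTree G = Connected G × Acyclic G

endpoints : {n : ℕ} → List (Fin n × Fin n) → List (Fin n)
endpoints []             = []
endpoints ((u , v) ∷ es) = u ∷ v ∷ endpoints es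

IsMatching : {n : ℕ} → Graph n → List (Fin n × Fin n) → Set
IsMatching G M = All (λ e → adj G (proj₁ e) (proj₂ e) ≡ true) M × Unique (endpoints M)

MatchingNumber : {n : ℕ} → Graph n → ℕ → Set
MatchingNumber G k =
  (Σ (List _) λ M → IsMatching G M × length M ≡ k) ×
  (∀ M → IsMatching G M → length M ≤ k)

_≅_ : {n : ℕ} → Graph n → Graph n → Set
_≅_ {n} G H = Σ (Fin n ↔ Fin n) λ σ →
  ∀ u v → adj G u v ≡ adj H (Inverse.to σ u) (Inverse.to σ v)

-- T_{n,m}: star K_{1,n-m} with centre 0 and leaves 1,…,n-m; a new pendent
-- vertex (n-m)+i is attached to leaf i for i = 1,…,m-1.
-- Total vertices: 1 + (n-m) + (m-1) = n  (for m ≥ 1, n-m ≥ m-1).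
Tadjℕ : ℕ → ℕ → ℕ → ℕ → Bool
Tadjℕ n m a b =
  ((a ≡ᵇ 0) ∧ (1 ≤ᵇ b) ∧ (b ≤ᵇ n ∸ m)) ∨
  ((1 ≤ᵇ a) ∧ (a ≤ᵇ m ∸ 1) ∧ (b ≡ᵇ (n ∸ m) + a))

-- symmetric closure, with loops excluded (loops never arise when n - m ≥ 1)
TadjSym : ℕ → ℕ → ℕ → ℕ → Bool
TadjSym n m a b = not (a ≡ᵇ b) ∧ (Tadjℕ n m a b ∨ Tadjℕ n m b a)

private
  ≡ᵇ-refl : ∀ a → (a ≡ᵇ a) ≡ true
  ≡ᵇ-refl zero    = refl
  ≡ᵇ-refl (suc a) = ≡ᵇ-refl a

  ≡ᵇ-sym : ∀ a b → (a ≡ᵇ b) ≡ (b ≡ᵇ a)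
  ≡ᵇ-sym zero    zero    = refl
  ≡ᵇ-sym zero    (suc b) = refl
  ≡ᵇ-sym (suc a) zero    = refl
  ≡ᵇ-sym (suc a) (suc b) = ≡ᵇ-sym a b

  TSym : ∀ n m a b → TadjSym n m a b ≡ TadjSym n m b a
  TSym n m a b rewrite ≡ᵇ-sym a b | ∨-comm (Tadjℕ n m a b) (Tadjℕ n m b a) = refl

  TIrr : ∀ n m a → TadjSym n m a a ≡ false
  TIrr n m a rewrite ≡ᵇ-refl a = refl

T : (n m : ℕ) → Graph n
T n m = record
  { adj    = λ u v → TadjSym n m (toℕ u) (toℕ v)
  ; sym    = λ u v → TSym n m (toℕ u) (toℕ v)
  ; irrefl = λ u → TIrr n m (toℕ u)
  }

{-# OPTIONS --safe #-}

-- A tree on 2m vertices with matching number m has a perfect matching; write its pairs as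
-- {p k, q k} with degrees a k, b k.  Since M₁ is the sum of the squared degrees,
-- M₁ = Σ (a k² + b k²).  A forest on 2m vertices has at most 2m - 1 edges, so
-- Σ (a k + b k) ≤ 4m - 2, and for m ≥ 2 connectivity gives a k + b k ≥ 3.  With
-- t k = a k + b k - 3 we have a² + b² = t² + 4t + 5 - 2(a - 1)(b - 1) and
-- Σ t k² = (Σ t k)² - 2 Σ_{j<k} t j t k, while Σ t k ≤ m - 2; hence M₁ + 4 ≤ m² + 5m, with
-- equality only if every pair contains a leaf, exactly one pair has degree sum m + 1 and
-- all others have degree sum 3.  These degrees determine the tree: a centre of degree m
-- adjacent to one leaf and to m - 1 vertices of degree 2, each carrying a pendant leaf,
-- which is T_{2m,m}.

module Submission where

open import Defs hiding (sym)
open import Data.Nat using (ℕ; zero; suc; _+_; _*_; _∸_; _≤_; _<_; z≤n; s≤s; z<s; s<s; _≤ᵇ_; _<ᵇ_; _≡ᵇ_; _≤?_; _<?_; _≟_)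
open import Data.Nat.Properties
open import Data.Nat.Solver using (module +-*-Solver)
open import Data.Fin using (Fin; toℕ; punchIn; punchOut)
import Data.Fin as Fin
open import Data.Fin.Properties
  using (toℕ-injective; toℕ<n; punchIn-punchOut; punchInᵢ≢i; punchIn-injective; punchOut-injective; injective⇒≤; any?)
open import Data.Bool using (Bool; true; false; _∧_; if_then_else_) renaming (T to Tᵇ)
import Data.Bool.Properties as Boolₚ
open import Data.List using (List; []; _∷_; length; map; lookup)
open import Data.List.Relation.Unary.All using (All; []; _∷_)
import Data.List.Relation.Unary.All as All
open import Data.List.Relation.Unary.All.Properties using (¬Any⇒All¬)
open import Data.List.Relation.Unary.Any using (here; there)
open import Data.List.Relation.Unary.AllPairs using ([]; _∷_)
open import Data.List.Relation.Unary.Unique.Propositional using (Unique)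
open import Data.List.Relation.Unary.Unique.Propositional.Properties using (map⁺)
open import Data.List.Membership.Propositional using (_∈_; _∉_)
open import Data.List.Membership.Propositional.Properties using (∈-lookup)
import Data.List.Membership.DecPropositional as DecMembership
open import Data.Product using (_×_; Σ; _,_; proj₁; proj₂; ∃; ∃₂)
open import Data.Sum using (_⊎_; inj₁; inj₂; [_,_])
open import Data.Empty using (⊥-elim)
open import Data.Unit using (tt)
open import Function using (_∘_)
open import Function.Bundles using (_⇔_; _↔_; Inverse; Equivalence; mk↔ₛ′; mk⇔)
open import Function.Construct.Symmetry using (↔-sym)
open import Relation.Binary using (tri<; tri≈; tri>)
open import Relation.Binary.PropositionalEquality
  using (_≡_; _≢_; refl; sym; trans; cong; cong₂; subst; subst₂; module ≡-Reasoning)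
open import Relation.Nullary using (¬_; Dec; yes; no)
open import Relation.Nullary.Decidable using (toSum; _⊎-dec_)
import Algebra.Properties.CommutativeMonoid.Sum as CommutativeMonoidSum

open +-*-Solver
module ∑ = CommutativeMonoidSum +-0-commutativeMonoid

sumFin≡sum : ∀ {n} (f : Fin n → ℕ) → sumFin f ≡ ∑.sum f
sumFin≡sum {zero}  f = refl
sumFin≡sum {suc n} f = cong (f Fin.zero +_) (sumFin≡sum (f ∘ Fin.suc))

sumFin-cong : ∀ {n} {f g : Fin n → ℕ} → (∀ i → f i ≡ g i) → sumFin f ≡ sumFin g
sumFin-cong {zero}  f≗g = refl
sumFin-cong {suc n} f≗g = cong₂ _+_ (f≗g Fin.zero) (sumFin-cong (f≗g ∘ Fin.suc))

sumFin-distrib-+ : ∀ {n} (f g : Fin n → ℕ) → sumFin (λ i → f i + g i) ≡ sumFin f + sumFin g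
sumFin-distrib-+ {n} f g = begin
  sumFin (λ i → f i + g i)  ≡⟨ sumFin≡sum {n} _ ⟩
  ∑.sum (λ i → f i + g i)   ≡⟨ ∑.∑-distrib-+ f g ⟩
  ∑.sum f + ∑.sum g         ≡⟨ sym (cong₂ _+_ (sumFin≡sum f) (sumFin≡sum g)) ⟩
  sumFin f + sumFin g       ∎
  where open ≡-Reasoning

sumFin-*ʳ : ∀ {n} (f : Fin n → ℕ) c → sumFin (λ i → f i * c) ≡ sumFin f * c
sumFin-*ʳ {zero}  f c = refl
sumFin-*ʳ {suc n} f c =
  trans (cong (f Fin.zero * c +_) (sumFin-*ʳ (f ∘ Fin.suc) c)) (sym (*-distribʳ-+ c (f Fin.zero) _))

sumFin-comm : ∀ {n} (f : Fin n → Fin n → ℕ) →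
              sumFin (λ u → sumFin (f u)) ≡ sumFin (λ v → sumFin (λ u → f u v))
sumFin-comm {n} f = begin
  sumFin (λ u → sumFin (f u))              ≡⟨ sumFin≡sum {n} _ ⟩
  ∑.sum (λ u → sumFin (f u))               ≡⟨ ∑.sum-cong-≗ (sumFin≡sum ∘ f) ⟩
  ∑.sum (λ u → ∑.sum (f u))                ≡⟨ ∑.∑-comm f ⟩
  ∑.sum (λ v → ∑.sum (λ u → f u v))        ≡⟨ sym (∑.sum-cong-≗ (λ v → sumFin≡sum (λ u → f u v))) ⟩
  ∑.sum (λ v → sumFin (λ u → f u v))       ≡⟨ sym (sumFin≡sum {n} _) ⟩
  sumFin (λ v → sumFin (λ u → f u v))      ∎
  where open ≡-Reasoning

sumFin-permute : ∀ {n} (σ : Fin n ↔ Fin n) (f : Fin n → ℕ) → sumFin (f ∘ Inverse.to σ) ≡ sumFin f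
sumFin-permute {n} σ f =
  trans (sumFin≡sum {n} _) (trans (sym (∑.sum-permute f σ)) (sym (sumFin≡sum f)))

sumFin-remove : ∀ {n} (f : Fin (suc n) → ℕ) (i : Fin (suc n)) → sumFin f ≡ f i + sumFin (f ∘ punchIn i)
sumFin-remove {n} f i =
  trans (sumFin≡sum f) (trans (∑.sum-remove {i = i} f) (cong (f i +_) (sym (sumFin≡sum {n} _))))

term≤sumFin : ∀ {n} (f : Fin n → ℕ) i → f i ≤ sumFin f
term≤sumFin {suc n} f i rewrite sumFin-remove f i = m≤m+n _ _

two-terms≤sumFin : ∀ {n} (f : Fin n → ℕ) {i j} → i ≢ j → f i + f j ≤ sumFin f
two-terms≤sumFin {suc n} f {i} {j} i≢j rewrite sumFin-remove f i =
  +-monoʳ-≤ (f i) (subst (λ k → f k ≤ _) (punchIn-punchOut i≢j) (term≤sumFin (f ∘ punchIn i) (punchOut i≢j)))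

three-terms≤sumFin : ∀ {n} (f : Fin n → ℕ) {i j k} → i ≢ j → i ≢ k → j ≢ k → f i + f j + f k ≤ sumFin f
three-terms≤sumFin {suc n} f {i} {j} {k} i≢j i≢k j≢k rewrite sumFin-remove f i | +-assoc (f i) (f j) (f k) =
  +-monoʳ-≤ (f i) (subst₂ (λ x y → f x + f y ≤ _) (punchIn-punchOut i≢j) (punchIn-punchOut i≢k)
    (two-terms≤sumFin (f ∘ punchIn i) λ eq →
      j≢k (trans (sym (punchIn-punchOut i≢j)) (trans (cong (punchIn i) eq) (punchIn-punchOut i≢k)))))

sumFin>0⇒term>0 : ∀ {n} (f : Fin n → ℕ) → 0 < sumFin f → ∃ λ i → 0 < f i
sumFin>0⇒term>0 {suc n} f pos with f Fin.zero in eq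
... | suc _ = Fin.zero , subst (0 <_) (sym eq) z<s
... | zero with sumFin>0⇒term>0 (f ∘ Fin.suc) pos
...   | i , fi>0 = Fin.suc i , fi>0

sumBelow : ℕ → (ℕ → ℕ) → ℕ
sumBelow zero    h = 0
sumBelow (suc n) h = h 0 + sumBelow n (h ∘ suc)

sumFin-toℕ : ∀ n (h : ℕ → ℕ) → sumFin {n} (h ∘ toℕ) ≡ sumBelow n h
sumFin-toℕ zero    h = refl
sumFin-toℕ (suc n) h = cong (h 0 +_) (sumFin-toℕ n (h ∘ suc))

sumBelow-cong : ∀ n {g h : ℕ → ℕ} → (∀ k → k < n → g k ≡ h k) → sumBelow n g ≡ sumBelow n h
sumBelow-cong zero    g≗h = refl
sumBelow-cong (suc n) g≗h = cong₂ _+_ (g≗h 0 z<s) (sumBelow-cong n (λ k k<n → g≗h (suc k) (s<s k<n)))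

sumBelow-mono-≤ : ∀ n {g h : ℕ → ℕ} → (∀ k → k < n → g k ≤ h k) → sumBelow n g ≤ sumBelow n h
sumBelow-mono-≤ zero    g≤h = z≤n
sumBelow-mono-≤ (suc n) g≤h = +-mono-≤ (g≤h 0 z<s) (sumBelow-mono-≤ n (λ k k<n → g≤h (suc k) (s<s k<n)))

sumBelow-+ : ∀ a b (h : ℕ → ℕ) → sumBelow (a + b) h ≡ sumBelow a h + sumBelow b (λ j → h (a + j))
sumBelow-+ zero    b h = refl
sumBelow-+ (suc a) b h = trans (cong (h 0 +_) (sumBelow-+ a b (h ∘ suc))) (sym (+-assoc (h 0) _ _))

sumBelow-distrib-+ : ∀ n (g h : ℕ → ℕ) → sumBelow n (λ k → g k + h k) ≡ sumBelow n g + sumBelow n h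
sumBelow-distrib-+ zero    g h = refl
sumBelow-distrib-+ (suc n) g h = begin
  g 0 + h 0 + sumBelow n (λ k → g (suc k) + h (suc k))
    ≡⟨ cong (g 0 + h 0 +_) (sumBelow-distrib-+ n (g ∘ suc) (h ∘ suc)) ⟩
  g 0 + h 0 + (sumBelow n (g ∘ suc) + sumBelow n (h ∘ suc))
    ≡⟨ solve 4 (λ a b c d → a :+ b :+ (c :+ d) := a :+ c :+ (b :+ d)) refl (g 0) (h 0) _ _ ⟩
  g 0 + sumBelow n (g ∘ suc) + (h 0 + sumBelow n (h ∘ suc))  ∎
  where open ≡-Reasoning

sumBelow-*ˡ : ∀ n c (h : ℕ → ℕ) → sumBelow n (λ k → c * h k) ≡ c * sumBelow n h
sumBelow-*ˡ zero    c h = sym (*-zeroʳ c)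
sumBelow-*ˡ (suc n) c h =
  trans (cong (c * h 0 +_) (sumBelow-*ˡ n c (h ∘ suc))) (sym (*-distribˡ-+ c (h 0) _))

sumBelow-const : ∀ n c → sumBelow n (λ _ → c) ≡ n * c
sumBelow-const zero    c = refl
sumBelow-const (suc n) c = cong (c +_) (sumBelow-const n c)

sumBelow-zero : ∀ n {h : ℕ → ℕ} → (∀ k → k < n → h k ≡ 0) → sumBelow n h ≡ 0
sumBelow-zero n h≗0 = trans (sumBelow-cong n h≗0) (trans (sumBelow-const n 0) (*-zeroʳ n))

sumBelow≡0⇒ : ∀ n (h : ℕ → ℕ) → sumBelow n h ≡ 0 → ∀ k → k < n → h k ≡ 0
sumBelow≡0⇒ (suc n) h sum≡0 zero    _         = m+n≡0⇒m≡0 (h 0) sum≡0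
sumBelow≡0⇒ (suc n) h sum≡0 (suc k) (s<s k<n) = sumBelow≡0⇒ n (h ∘ suc) (m+n≡0⇒n≡0 (h 0) sum≡0) k k<n

sumBelow-single : ∀ n (h : ℕ → ℕ) {i} → i < n → (∀ k → k < n → k ≢ i → h k ≡ 0) → sumBelow n h ≡ h i
sumBelow-single (suc n) h {zero} _ others≡0 =
  trans (cong (h 0 +_) (sumBelow-zero n (λ k k<n → others≡0 (suc k) (s<s k<n) λ ()))) (+-identityʳ (h 0))
sumBelow-single (suc n) h {suc i} (s<s i<n) others≡0 =
  trans (cong (_+ sumBelow n (h ∘ suc)) (others≡0 0 z<s λ ()))
        (sumBelow-single n (h ∘ suc) i<n (λ k k<n k≢i → others≡0 (suc k) (s<s k<n) (k≢i ∘ suc-injective)))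

sumBelow≡n⇒all≡1 : ∀ n (h : ℕ → ℕ) → (∀ k → k < n → h k ≤ 1) → sumBelow n h ≡ n → ∀ k → k < n → h k ≡ 1
sumBelow≡n⇒all≡1 (suc n) h h≤1 sum≡n k k<n with h 0 in eq | h≤1 0 z<s
... | suc (suc _) | s≤s ()
... | zero | _ = ⊥-elim (1+n≰n (begin
      suc n                     ≡⟨ sum≡n ⟨
      sumBelow n (h ∘ suc)      ≤⟨ sumBelow-mono-≤ n (λ j j<n → h≤1 (suc j) (s<s j<n)) ⟩
      sumBelow n (λ _ → 1)      ≡⟨ trans (sumBelow-const n 1) (*-identityʳ n) ⟩
      n                         ∎))
  where open ≤-Reasoning
... | suc zero | _ with k | k<n
...   | zero   | _         = eq
...   | suc k′ | s<s k′<n  =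
  sumBelow≡n⇒all≡1 n (h ∘ suc) (λ j j<n → h≤1 (suc j) (s<s j<n)) (suc-injective sum≡n) k′ k′<n

crossSum : ℕ → (ℕ → ℕ) → ℕ
crossSum zero    t = 0
crossSum (suc n) t = t 0 * sumBelow n (t ∘ suc) + crossSum n (t ∘ suc)

sumBelow-square : ∀ n t → sumBelow n (λ k → t k * t k) + 2 * crossSum n t ≡ sumBelow n t * sumBelow n t
sumBelow-square zero    t = refl
sumBelow-square (suc n) t = begin
  t 0 * t 0 + S + 2 * (t 0 * R + C)  ≡⟨ solve 4 (λ a s r c → a :* a :+ s :+ con 2 :* (a :* r :+ c)
                                                := a :* a :+ con 2 :* a :* r :+ (s :+ con 2 :* c)) refl (t 0) S R C ⟩
  t 0 * t 0 + 2 * t 0 * R + (S + 2 * C)  ≡⟨ cong (t 0 * t 0 + 2 * t 0 * R +_) (sumBelow-square n (t ∘ suc)) ⟩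
  t 0 * t 0 + 2 * t 0 * R + R * R        ≡⟨ solve 2 (λ a r → a :* a :+ con 2 :* a :* r :+ r :* r
                                                := (a :+ r) :* (a :+ r)) refl (t 0) R ⟩
  (t 0 + R) * (t 0 + R)                  ∎
  where
  open ≡-Reasoning
  S R C : ℕ
  S = sumBelow n (λ k → t (suc k) * t (suc k))
  R = sumBelow n (t ∘ suc)
  C = crossSum n (t ∘ suc)

SupportedAt : ℕ → (ℕ → ℕ) → ℕ → Set
SupportedAt n t i = ∀ k → k < n → k ≢ i → t k ≡ 0

crossSum≡0⇒supportedAt : ∀ n t → 1 ≤ n → crossSum n t ≡ 0 → ∃ λ i → i < n × SupportedAt n t i
crossSum≡0⇒supportedAt (suc zero) t _ _ = 0 , z<s , λ { zero _ 0≢0 → ⊥-elim (0≢0 refl) ; (suc k) (s<s ()) _ }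
crossSum≡0⇒supportedAt (suc n@(suc _)) t _ cross≡0 =
  extend (t 0 ≟ 0) (crossSum≡0⇒supportedAt n (t ∘ suc) (s≤s z≤n) (m+n≡0⇒n≡0 (t 0 * _) cross≡0))
  where
  extend : Dec (t 0 ≡ 0) → ∃ (λ i → i < n × SupportedAt n (t ∘ suc) i) → ∃ λ i → i < suc n × SupportedAt (suc n) t i
  extend (yes t0≡0) (i , i<n , supp) =
    suc i , s<s i<n , λ { zero _ _ → t0≡0 ; (suc k) (s<s k<n) k≢i → supp k k<n (k≢i ∘ cong suc) }
  extend (no t0≢0) _ with m*n≡0⇒m≡0∨n≡0 (t 0) (m+n≡0⇒m≡0 (t 0 * _) cross≡0)
  ... | inj₁ t0≡0   = ⊥-elim (t0≢0 t0≡0)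
  ... | inj₂ rest≡0 =
    0 , z<s , λ { zero _ 0≢0 → ⊥-elim (0≢0 refl) ; (suc k) (s<s k<n) _ → sumBelow≡0⇒ n (t ∘ suc) rest≡0 k k<n }

-- Degree sequences of a perfectly matched forest

pair-squares : ∀ a b → 1 ≤ a → 1 ≤ b → 3 ≤ a + b →
  a * a + b * b + 2 * ((a ∸ 1) * (b ∸ 1)) ≡ (a + b ∸ 3) * (a + b ∸ 3) + 4 * (a + b ∸ 3) + 5
pair-squares (suc x) (suc y) _ _ 3≤a+b with x + y in eq
... | zero  = ⊥-elim (<⇒≱ (s≤s (s≤s (s≤s z≤n))) (subst (3 ≤_) (cong suc (trans (+-suc x y) (cong suc eq))) 3≤a+b))
... | suc r = begin
  suc x * suc x + suc y * suc y + 2 * (x * y)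
    ≡⟨ solve 2 (λ x y → (con 1 :+ x) :* (con 1 :+ x) :+ (con 1 :+ y) :* (con 1 :+ y) :+ con 2 :* (x :* y)
                      := (x :+ y) :* (x :+ y) :+ con 2 :* (x :+ y) :+ con 2) refl x y ⟩
  (x + y) * (x + y) + 2 * (x + y) + 2
    ≡⟨ cong (λ s → s * s + 2 * s + 2) eq ⟩
  suc r * suc r + 2 * suc r + 2
    ≡⟨ solve 1 (λ r → (con 1 :+ r) :* (con 1 :+ r) :+ con 2 :* (con 1 :+ r) :+ con 2
                    := r :* r :+ con 4 :* r :+ con 5) refl r ⟩
  r * r + 4 * r + 5
    ≡⟨ cong (λ s → (s ∸ 3) * (s ∸ 3) + 4 * (s ∸ 3) + 5) (cong suc (trans (+-suc x y) (cong suc eq))) ⟨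
  (suc x + suc y ∸ 3) * (suc x + suc y ∸ 3) + 4 * (suc x + suc y ∸ 3) + 5  ∎
  where open ≡-Reasoning

record DegreeProfile (m : ℕ) (a b : ℕ → ℕ) : Set where
  field
    a≥1       : ∀ k → k < m → 1 ≤ a k
    b≥1       : ∀ k → k < m → 1 ≤ b k
    a+b≥3     : ∀ k → k < m → 3 ≤ a k + b k
    handshake : sumBelow m (λ k → a k + b k) + 2 ≤ 2 * (2 * m)

-- The degree pattern of T_{2m,m} along its perfect matching.
Extremal : ℕ → (ℕ → ℕ) → (ℕ → ℕ) → Set
Extremal m a b = ∃ λ i → i < m
  × (∀ k → k < m → a k ≡ 1 ⊎ b k ≡ 1)
  × a i + b i ≡ suc m
  × (∀ k → k < m → k ≢ i → a k + b k ≡ 3)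

module DegreeProfileBound {m a b} (profile : DegreeProfile m a b) where
  open DegreeProfile profile

  excess : ℕ → ℕ
  excess k = a k + b k ∸ 3

  leafDefect : ℕ → ℕ
  leafDefect k = (a k ∸ 1) * (b k ∸ 1)

  excess-total : ℕ
  excess-total = sumBelow m excess

  private
    squares defects crosses : ℕ
    squares = sumBelow m (λ k → a k * a k + b k * b k)
    defects = sumBelow m leafDefect
    crosses = crossSum m excess

    pair≡excess+3 : ∀ k → k < m → a k + b k ≡ excess k + 3
    pair≡excess+3 k k<m = sym (m∸n+n≡m (a+b≥3 k k<m))

    degree-total : sumBelow m (λ k → a k + b k) ≡ excess-total + m * 3
    degree-total = begin
      sumBelow m (λ k → a k + b k)       ≡⟨ sumBelow-cong m pair≡excess+3 ⟩
      sumBelow m (λ k → excess k + 3)    ≡⟨ sumBelow-distrib-+ m excess (λ _ → 3) ⟩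
      excess-total + sumBelow m (λ _ → 3) ≡⟨ cong (excess-total +_) (sumBelow-const m 3) ⟩
      excess-total + m * 3               ∎
      where open ≡-Reasoning

    squares+defects : squares + 2 * defects ≡ sumBelow m (λ k → excess k * excess k) + 4 * excess-total + m * 5
    squares+defects = begin
      squares + 2 * defects
        ≡⟨ cong (squares +_) (sumBelow-*ˡ m 2 leafDefect) ⟨
      squares + sumBelow m (λ k → 2 * leafDefect k)
        ≡⟨ sumBelow-distrib-+ m _ _ ⟨
      sumBelow m (λ k → a k * a k + b k * b k + 2 * leafDefect k)
        ≡⟨ sumBelow-cong m (λ k k<m → pair-squares (a k) (b k) (a≥1 k k<m) (b≥1 k k<m) (a+b≥3 k k<m)) ⟩
      sumBelow m (λ k → excess k * excess k + 4 * excess k + 5)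
        ≡⟨ sumBelow-distrib-+ m _ _ ⟩
      sumBelow m (λ k → excess k * excess k + 4 * excess k) + sumBelow m (λ _ → 5)
        ≡⟨ cong₂ _+_ (trans (sumBelow-distrib-+ m (λ k → excess k * excess k) _) (cong (sumBelow m (λ k → excess k * excess k) +_) (sumBelow-*ˡ m 4 excess))) (sumBelow-const m 5) ⟩
      sumBelow m (λ k → excess k * excess k) + 4 * excess-total + m * 5  ∎
      where open ≡-Reasoning

  excess-total+2≤m : excess-total + 2 ≤ m
  excess-total+2≤m = +-cancelʳ-≤ (m * 3) _ _ (begin
    excess-total + 2 + m * 3           ≡⟨ solve 2 (λ e m → e :+ con 2 :+ m :* con 3 := e :+ m :* con 3 :+ con 2) refl excess-total m ⟩
    excess-total + m * 3 + 2           ≡⟨ cong (_+ 2) degree-total ⟨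
    sumBelow m (λ k → a k + b k) + 2   ≤⟨ handshake ⟩
    2 * (2 * m)                        ≡⟨ solve 1 (λ m → con 2 :* (con 2 :* m) := m :+ m :* con 3) refl m ⟩
    m + m * 3                          ∎)
    where open ≤-Reasoning

  gap : ℕ
  gap = m ∸ (excess-total + 2)

  slack : ℕ
  slack = 2 * defects + 2 * crosses + 2 * excess-total * gap + gap * gap + 4 * gap

  squares+slack : squares + 4 + slack ≡ m * m + 5 * m
  squares+slack = begin
    squares + 4 + slack
      ≡⟨ solve 5 (λ L C X T g → L :+ con 4 :+ (con 2 :* C :+ con 2 :* X :+ con 2 :* T :* g :+ g :* g :+ con 4 :* g)
                             := (L :+ con 2 :* C) :+ con 2 :* X :+ con 4 :+ con 2 :* T :* g :+ g :* g :+ con 4 :* g)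
               refl squares defects crosses excess-total gap ⟩
    (squares + 2 * defects) + 2 * crosses + 4 + 2 * excess-total * gap + gap * gap + 4 * gap
      ≡⟨ cong (λ s → s + 2 * crosses + 4 + 2 * excess-total * gap + gap * gap + 4 * gap) squares+defects ⟩
    (Q + 4 * excess-total + m * 5) + 2 * crosses + 4 + 2 * excess-total * gap + gap * gap + 4 * gap
      ≡⟨ solve 5 (λ Q T m X g → (Q :+ con 4 :* T :+ m :* con 5) :+ con 2 :* X :+ con 4 :+ con 2 :* T :* g :+ g :* g :+ con 4 :* g
                             := (Q :+ con 2 :* X) :+ con 4 :* T :+ con 4 :+ con 2 :* T :* g :+ g :* g :+ con 4 :* g :+ con 5 :* m)
               refl Q excess-total m crosses gap ⟩
    (Q + 2 * crosses) + 4 * excess-total + 4 + 2 * excess-total * gap + gap * gap + 4 * gap + 5 * m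
      ≡⟨ cong (λ s → s + 4 * excess-total + 4 + 2 * excess-total * gap + gap * gap + 4 * gap + 5 * m) (sumBelow-square m excess) ⟩
    excess-total * excess-total + 4 * excess-total + 4 + 2 * excess-total * gap + gap * gap + 4 * gap + 5 * m
      ≡⟨ cong (_+ 5 * m) (solve 2 (λ T g → T :* T :+ con 4 :* T :+ con 4 :+ con 2 :* T :* g :+ g :* g :+ con 4 :* g
                                        := (T :+ con 2 :+ g) :* (T :+ con 2 :+ g)) refl excess-total gap) ⟩
    (excess-total + 2 + gap) * (excess-total + 2 + gap) + 5 * m
      ≡⟨ cong (λ s → s * s + 5 * m) (m+[n∸m]≡n excess-total+2≤m) ⟩
    m * m + 5 * m  ∎
    where
    open ≡-Reasoning
    Q : ℕ
    Q = sumBelow m (λ k → excess k * excess k)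

  slack≡0⇒extremal : slack ≡ 0 → Extremal m a b
  slack≡0⇒extremal slack≡0 = i , i<m , leaf-in-every-pair , centre-pair , other-pairs
    where
    gap≡0 : gap ≡ 0
    gap≡0 = m*n≡0⇒m≡0 gap 4 (trans (*-comm gap 4) (m+n≡0⇒n≡0 (2 * defects + 2 * crosses + 2 * excess-total * gap + gap * gap) slack≡0))

    defects+crosses≡0 : 2 * defects + 2 * crosses ≡ 0
    defects+crosses≡0 = m+n≡0⇒m≡0 _ (m+n≡0⇒m≡0 _ (m+n≡0⇒m≡0 _ slack≡0))

    defects≡0 : defects ≡ 0
    defects≡0 = m*n≡0⇒m≡0 defects 2 (trans (*-comm defects 2) (m+n≡0⇒m≡0 _ defects+crosses≡0))

    crosses≡0 : crosses ≡ 0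
    crosses≡0 = m*n≡0⇒m≡0 crosses 2 (trans (*-comm crosses 2) (m+n≡0⇒n≡0 (2 * defects) defects+crosses≡0))

    single-excess : ∃ λ i → i < m × SupportedAt m excess i
    single-excess = crossSum≡0⇒supportedAt m excess (≤-trans (s≤s z≤n) (m+n≤o⇒n≤o excess-total excess-total+2≤m)) crosses≡0

    i : ℕ
    i = proj₁ single-excess

    i<m : i < m
    i<m = proj₁ (proj₂ single-excess)

    excess-elsewhere≡0 : SupportedAt m excess i
    excess-elsewhere≡0 = proj₂ (proj₂ single-excess)

    leaf-in-every-pair : ∀ k → k < m → a k ≡ 1 ⊎ b k ≡ 1
    leaf-in-every-pair k k<m with m*n≡0⇒m≡0∨n≡0 (a k ∸ 1) (sumBelow≡0⇒ m leafDefect defects≡0 k k<m)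
    ... | inj₁ a∸1≡0 = inj₁ (≤-antisym (m∸n≡0⇒m≤n a∸1≡0) (a≥1 k k<m))
    ... | inj₂ b∸1≡0 = inj₂ (≤-antisym (m∸n≡0⇒m≤n b∸1≡0) (b≥1 k k<m))

    other-pairs : ∀ k → k < m → k ≢ i → a k + b k ≡ 3
    other-pairs k k<m k≢i = trans (pair≡excess+3 k k<m) (cong (_+ 3) (excess-elsewhere≡0 k k<m k≢i))

    centre-pair : a i + b i ≡ suc m
    centre-pair = begin
      a i + b i               ≡⟨ pair≡excess+3 i i<m ⟩
      excess i + 3            ≡⟨ cong (_+ 3) (sumBelow-single m excess i<m excess-elsewhere≡0) ⟨
      excess-total + 3        ≡⟨ +-comm excess-total 3 ⟩
      suc (2 + excess-total)  ≡⟨ cong suc (+-comm 2 excess-total) ⟩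
      suc (excess-total + 2)  ≡⟨ cong suc (trans (sym (+-identityʳ _)) (cong (excess-total + 2 +_) (sym gap≡0))) ⟩
      suc (excess-total + 2 + gap) ≡⟨ cong suc (m+[n∸m]≡n excess-total+2≤m) ⟩
      suc m                   ∎
      where open ≡-Reasoning

Tᵇ⇒≡true : ∀ {b} → Tᵇ b → b ≡ true
Tᵇ⇒≡true = Equivalence.to Boolₚ.T-≡

¬Tᵇ⇒≡false : ∀ {b} → ¬ Tᵇ b → b ≡ false
¬Tᵇ⇒≡false ¬t = Boolₚ.¬-not (¬t ∘ Equivalence.from Boolₚ.T-≡)

≡ᵇ-sym : ∀ i j → (i ≡ᵇ j) ≡ (j ≡ᵇ i)
≡ᵇ-sym zero    zero    = refl
≡ᵇ-sym zero    (suc j) = refl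
≡ᵇ-sym (suc i) zero    = refl
≡ᵇ-sym (suc i) (suc j) = ≡ᵇ-sym i j

true≢false : true ≢ false
true≢false ()

b2n≤1 : ∀ b → b2n b ≤ 1
b2n≤1 true  = s≤s z≤n
b2n≤1 false = z≤n

b2n>0⇒≡true : ∀ {b} → 0 < b2n b → b ≡ true
b2n>0⇒≡true {true} _ = refl

b2n≡1⇒≡true : ∀ {b} → b2n b ≡ 1 → b ≡ true
b2n≡1⇒≡true {true} _ = refl

b2n-true : ∀ {b} → b ≡ true → b2n b ≡ 1
b2n-true refl = refl

-- Degrees and the first Zagreb index

module _ {n : ℕ} (G : Graph n) where

  adj-sym : ∀ {u v} → adj G u v ≡ true → adj G v u ≡ true
  adj-sym {u} {v} uv = trans (Graph.sym G v u) uv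

  adj⇒≢ : ∀ {u v} → adj G u v ≡ true → u ≢ v
  adj⇒≢ {u} uv refl = true≢false (trans (sym uv) (irrefl G u))

  adj⇒degree≥1 : ∀ {u v} → adj G u v ≡ true → 1 ≤ degree G u
  adj⇒degree≥1 {u} {v} uv = subst (_≤ degree G u) (b2n-true uv) (term≤sumFin (b2n ∘ adj G u) v)

  two-neighbours⇒degree≥2 : ∀ {u v w} → adj G u v ≡ true → adj G u w ≡ true → v ≢ w → 2 ≤ degree G u
  two-neighbours⇒degree≥2 {u} uv uw v≢w =
    subst (_≤ degree G u) (cong₂ _+_ (b2n-true uv) (b2n-true uw)) (two-terms≤sumFin (b2n ∘ adj G u) v≢w)

  degree≡1⇒unique-neighbour : ∀ {u v w} → degree G u ≡ 1 → adj G u v ≡ true → adj G u w ≡ true → w ≡ v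
  degree≡1⇒unique-neighbour {u} {v} {w} deg≡1 uv uw with w Fin.≟ v
  ... | yes w≡v = w≡v
  ... | no  w≢v = ⊥-elim (1+n≰n (subst (2 ≤_) deg≡1 (two-neighbours⇒degree≥2 uv uw (w≢v ∘ sym))))

  degree≡2⇒two-neighbours : ∀ {u v w x} → degree G u ≡ 2 → adj G u v ≡ true → adj G u w ≡ true → v ≢ w →
                            adj G u x ≡ true → x ≡ v ⊎ x ≡ w
  degree≡2⇒two-neighbours {u} {v} {w} {x} deg≡2 uv uw v≢w ux with x Fin.≟ v | x Fin.≟ w
  ... | yes x≡v | _       = inj₁ x≡v
  ... | no _    | yes x≡w = inj₂ x≡w
  ... | no x≢v  | no x≢w  = ⊥-elim (1+n≰n (subst (3 ≤_) deg≡2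
        (subst (_≤ degree G u) (cong₂ _+_ (cong₂ _+_ (b2n-true uv) (b2n-true uw)) (b2n-true ux))
          (three-terms≤sumFin (b2n ∘ adj G u) v≢w (x≢v ∘ sym) (x≢w ∘ sym)))))

degree≥2⇒other-neighbour : ∀ {n} (G : Graph (suc n)) u v → 2 ≤ degree G u → ∃ λ w → adj G u w ≡ true × w ≢ v
degree≥2⇒other-neighbour G u v deg≥2 with sumFin>0⇒term>0 (b2n ∘ adj G u ∘ punchIn v) (+-cancelˡ-≤ 1 _ _ (begin
    2                                                     ≤⟨ deg≥2 ⟩
    degree G u                                            ≡⟨ sumFin-remove (b2n ∘ adj G u) v ⟩
    b2n (adj G u v) + sumFin (b2n ∘ adj G u ∘ punchIn v)  ≤⟨ +-monoˡ-≤ _ (b2n≤1 (adj G u v)) ⟩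
    1 + sumFin (b2n ∘ adj G u ∘ punchIn v)                ∎))
  where open ≤-Reasoning
... | i , uw = punchIn v i , b2n>0⇒≡true uw , punchInᵢ≢i v i

module _ {n : ℕ} (G : Graph n) where
  private
    d : Fin n → ℕ
    d = degree G

    edgeTerm : Fin n → Fin n → ℕ
    edgeTerm u v = if (toℕ u <ᵇ toℕ v) ∧ adj G u v then d u + d v else 0

    <ᵇ-true : ∀ {x y} → x < y → (x <ᵇ y) ≡ true
    <ᵇ-true x<y = Tᵇ⇒≡true (<⇒<ᵇ x<y)

    <ᵇ-false : ∀ {x y} → y ≤ x → (x <ᵇ y) ≡ false
    <ᵇ-false {x} {y} y≤x = ¬Tᵇ⇒≡false (λ x<ᵇy → <⇒≱ (<ᵇ⇒< x y x<ᵇy) y≤x)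

    if-edge : ∀ b x y → (if b then x + y else 0) ≡ b2n b * x + b2n b * y
    if-edge true  x y = sym (cong₂ _+_ (+-identityʳ x) (+-identityʳ y))
    if-edge false x y = refl

    edgeTerm-pair : ∀ u v → edgeTerm u v + edgeTerm v u ≡ b2n (adj G u v) * d u + b2n (adj G u v) * d v
    edgeTerm-pair u v with <-cmp (toℕ u) (toℕ v)
    ... | tri< u<v _ _ rewrite <ᵇ-true u<v | <ᵇ-false (<⇒≤ u<v) =
      trans (+-identityʳ _) (if-edge (adj G u v) (d u) (d v))
    ... | tri> _ _ v<u rewrite <ᵇ-true v<u | <ᵇ-false (<⇒≤ v<u) | Graph.sym G v u =
      trans (if-edge (adj G u v) (d v) (d u)) (+-comm (b2n (adj G u v) * d v) _)
    ... | tri≈ _ u≡v _ rewrite toℕ-injective u≡v | <ᵇ-false (≤-refl {toℕ v}) | irrefl G v = refl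

  M₁≡sum-degree² : M₁ G ≡ sumFin (λ u → degree G u * degree G u)
  M₁≡sum-degree² = *-cancelˡ-≡ (M₁ G) _ 2 (begin
    2 * M₁ G
      ≡⟨ cong (M₁ G +_) (+-identityʳ _) ⟩
    M₁ G + M₁ G
      ≡⟨ cong (M₁ G +_) (sumFin-comm edgeTerm) ⟩
    sumFin (λ u → sumFin (edgeTerm u)) + sumFin (λ u → sumFin (λ v → edgeTerm v u))
      ≡⟨ sumFin-distrib-+ {n} _ _ ⟨
    sumFin (λ u → sumFin (edgeTerm u) + sumFin (λ v → edgeTerm v u))
      ≡⟨ sumFin-cong {n} (λ u → sumFin-distrib-+ {n} _ _) ⟨
    sumFin (λ u → sumFin (λ v → edgeTerm u v + edgeTerm v u))
      ≡⟨ sumFin-cong {n} (λ u → sumFin-cong {n} (edgeTerm-pair u)) ⟩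
    sumFin (λ u → sumFin (λ v → uv u v * d u + uv u v * d v))
      ≡⟨ sumFin-cong {n} (λ u → sumFin-distrib-+ {n} _ _) ⟩
    sumFin (λ u → sumFin (λ v → uv u v * d u) + sumFin (λ v → uv u v * d v))
      ≡⟨ sumFin-distrib-+ {n} _ _ ⟩
    sumFin (λ u → sumFin (λ v → uv u v * d u)) + sumFin (λ u → sumFin (λ v → uv u v * d v))
      ≡⟨ cong₂ _+_ (sumFin-cong {n} (λ u → sumFin-*ʳ {n} _ (d u))) (sumFin-comm {n} _) ⟩
    sumFin (λ u → d u * d u) + sumFin (λ v → sumFin (λ u → uv u v * d v))
      ≡⟨ cong (sumFin (λ u → d u * d u) +_) (sumFin-cong {n} (λ v →
           trans (sumFin-cong {n} (λ u → cong (λ b → b2n b * d v) (Graph.sym G u v))) (sumFin-*ʳ {n} _ (d v)))) ⟩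
    sumFin (λ u → d u * d u) + sumFin (λ u → d u * d u)
      ≡⟨ cong (sumFin (λ u → d u * d u) +_) (+-identityʳ _) ⟨
    2 * sumFin (λ u → d u * d u)  ∎)
    where
    open ≡-Reasoning
    uv : Fin n → Fin n → ℕ
    uv u v = b2n (adj G u v)

-- Leaves and edge counts of forests

Unique-lookup-injective : ∀ {A : Set} {xs : List A} → Unique xs → ∀ i j → lookup xs i ≡ lookup xs j → i ≡ j
Unique-lookup-injective (_ ∷ _)         Fin.zero    Fin.zero    _  = refl
Unique-lookup-injective (x∉xs ∷ _)      Fin.zero    (Fin.suc j) eq = ⊥-elim (All.lookup x∉xs (∈-lookup j) eq)
Unique-lookup-injective (x∉xs ∷ _)      (Fin.suc i) Fin.zero    eq = ⊥-elim (All.lookup x∉xs (∈-lookup i) (sym eq))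
Unique-lookup-injective (_ ∷ xs-unique) (Fin.suc i) (Fin.suc j) eq = cong Fin.suc (Unique-lookup-injective xs-unique i j eq)

Unique⇒length≤ : ∀ {n} {xs : List (Fin n)} → Unique xs → length xs ≤ n
Unique⇒length≤ xs-unique = injective⇒≤ (λ {i} {j} → Unique-lookup-injective xs-unique i j)

takeThrough : ∀ {n} {x : Fin n} {ys} → x ∈ ys → Fin n × List (Fin n)
takeThrough (here {y} _)  = y , []
takeThrough (there {y} q) = y , (proj₁ (takeThrough q) ∷ proj₂ (takeThrough q))

module _ {n : ℕ} {x : Fin n} where

  last-takeThrough : ∀ {ys} (x∈ys : x ∈ ys) → last (proj₁ (takeThrough x∈ys)) (proj₂ (takeThrough x∈ys)) ≡ x
  last-takeThrough (here x≡y) = sym x≡y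
  last-takeThrough (there q)  = last-takeThrough q

  Chain-takeThrough : ∀ (G : Graph n) u {ys} (x∈ys : x ∈ ys) → Chain G (u ∷ ys) →
                      Chain G (u ∷ proj₁ (takeThrough x∈ys) ∷ proj₂ (takeThrough x∈ys))
  Chain-takeThrough G u (here _)                  (uy , _)     = uy , tt
  Chain-takeThrough G u (there {_} {_ ∷ _} x∈ys) (uy , chain) = uy , Chain-takeThrough G _ x∈ys chain

  All-takeThrough : ∀ {P : Fin n → Set} {ys} (x∈ys : x ∈ ys) → All P ys → All P (proj₁ (takeThrough x∈ys) ∷ proj₂ (takeThrough x∈ys))
  All-takeThrough (here _)                  (py ∷ _)   = py ∷ []
  All-takeThrough (there {_} {_ ∷ _} x∈ys) (py ∷ pys) = py ∷ All-takeThrough x∈ys pys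

  Unique-takeThrough : ∀ {ys} (x∈ys : x ∈ ys) → Unique ys → Unique (proj₁ (takeThrough x∈ys) ∷ proj₂ (takeThrough x∈ys))
  Unique-takeThrough (here _)                  (_ ∷ _)          = [] ∷ []
  Unique-takeThrough (there {_} {_ ∷ _} x∈ys) (y∉ys ∷ unique) = All-takeThrough x∈ys y∉ys ∷ Unique-takeThrough x∈ys unique

module _ {n : ℕ} (G : Graph (suc n)) (acyclic : Acyclic G) where

  private
    previous : Fin (suc n) → List (Fin (suc n)) → Fin (suc n)
    previous w []      = w
    previous w (v ∷ _) = v

    -- A path is kept reversed: its current end w is the head, its start the last element.
    neighbour-off-path : ∀ w path x → Unique (w ∷ path) → Chain G (w ∷ path) → adj G w x ≡ true →
                         x ≢ previous w path → x ∉ w ∷ path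
    neighbour-off-path w path x _ _ wx _ (here x≡w) = adj⇒≢ G wx (sym x≡w)
    neighbour-off-path w (v ∷ _) x _ _ _ x≢v (there (here x≡v)) = x≢v x≡v
    neighbour-off-path w (v ∷ path) x (w∉ ∷ (v∉ ∷ unique)) (wv , chain) wx _ (there (there x∈path)) =
      acyclic record
        { v₀       = w
        ; v₁       = v
        ; v₂       = proj₁ (takeThrough x∈path)
        ; rest     = proj₂ (takeThrough x∈path)
        ; distinct = w∉′ w∉ ∷ All-takeThrough x∈path v∉ ∷ Unique-takeThrough x∈path unique
        ; chain    = wv , Chain-takeThrough G v x∈path chain
        ; closing  = subst (λ y → adj G y w ≡ true) (sym (last-takeThrough x∈path)) (adj-sym G wx)
        }
      where
      w∉′ : All (w ≢_) (v ∷ path) → All (w ≢_) (v ∷ proj₁ (takeThrough x∈path) ∷ proj₂ (takeThrough x∈path))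
      w∉′ (w≢v ∷ w∉path) = w≢v ∷ All-takeThrough x∈path w∉path

  -- Extend a path at its head through a neighbour other than the previous vertex; by
  -- acyclicity that neighbour is new, so the extension stops within n steps, at a leaf.
  path⇒leaf : ∀ fuel w path → Unique (w ∷ path) → Chain G (w ∷ path) → suc n ≤ fuel + length (w ∷ path) →
              ∃ λ ℓ → degree G ℓ ≤ 1
  path⇒leaf fuel w path unique chain bound with degree G w ≤? 1
  ... | yes leaf = w , leaf
  ... | no ¬leaf with degree≥2⇒other-neighbour G w (previous w path) (≰⇒> ¬leaf)
  ... | x , wx , x≢prev with fuel | ¬Any⇒All¬ _ (neighbour-off-path w path x unique chain wx x≢prev)
  ...   | zero      | x∉ = ⊥-elim (<⇒≱ (s≤s bound) (Unique⇒length≤ {xs = x ∷ w ∷ path} (x∉ ∷ unique)))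
  ...   | suc fuel′ | x∉ = path⇒leaf fuel′ x (w ∷ path) (x∉ ∷ unique) (adj-sym G wx , chain)
                             (subst (suc n ≤_) (sym (+-suc fuel′ _)) bound)

  acyclic⇒leaf : ∃ λ ℓ → degree G ℓ ≤ 1
  acyclic⇒leaf = path⇒leaf (suc n) Fin.zero [] ([] ∷ []) tt (m≤m+n (suc n) 1)

removeVertex : ∀ {n} → Graph (suc n) → Fin (suc n) → Graph n
removeVertex G ℓ = record
  { adj    = λ i j → adj G (punchIn ℓ i) (punchIn ℓ j)
  ; sym    = λ i j → Graph.sym G (punchIn ℓ i) (punchIn ℓ j)
  ; irrefl = λ i → irrefl G (punchIn ℓ i)
  }

Chain-removeVertex : ∀ {n} (G : Graph (suc n)) ℓ xs → Chain (removeVertex G ℓ) xs → Chain G (map (punchIn ℓ) xs)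
Chain-removeVertex G ℓ []           _            = tt
Chain-removeVertex G ℓ (_ ∷ [])     _            = tt
Chain-removeVertex G ℓ (_ ∷ y ∷ xs) (xy , chain) = xy , Chain-removeVertex G ℓ (y ∷ xs) chain

last-map : ∀ {A B : Set} (f : A → B) a xs → last (f a) (map f xs) ≡ f (last a xs)
last-map f a []       = refl
last-map f a (x ∷ xs) = last-map f x xs

Acyclic-removeVertex : ∀ {n} (G : Graph (suc n)) ℓ → Acyclic G → Acyclic (removeVertex G ℓ)
Acyclic-removeVertex G ℓ acyclic cycle = acyclic record
  { v₀       = punchIn ℓ v₀
  ; v₁       = punchIn ℓ v₁
  ; v₂       = punchIn ℓ v₂
  ; rest     = map (punchIn ℓ) rest
  ; distinct = map⁺ (λ {x} {y} → punchIn-injective ℓ x y) distinct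
  ; chain    = Chain-removeVertex G ℓ (v₀ ∷ v₁ ∷ v₂ ∷ rest) chain
  ; closing  = subst (λ y → adj G y (punchIn ℓ v₀) ≡ true) (sym (last-map (punchIn ℓ) v₂ rest)) closing
  }
  where open Cycle cycle

sum-degree-removeVertex : ∀ {n} (G : Graph (suc n)) ℓ →
  sumFin (degree G) ≡ degree G ℓ + degree G ℓ + sumFin (degree (removeVertex G ℓ))
sum-degree-removeVertex {n} G ℓ = begin
  sumFin (degree G)
    ≡⟨ sumFin-remove (degree G) ℓ ⟩
  degree G ℓ + sumFin (degree G ∘ punchIn ℓ)
    ≡⟨ cong (degree G ℓ +_) (sumFin-cong {n} (λ i → sumFin-remove (b2n ∘ adj G (punchIn ℓ i)) ℓ)) ⟩
  degree G ℓ + sumFin (λ i → b2n (adj G (punchIn ℓ i) ℓ) + degree (removeVertex G ℓ) i)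
    ≡⟨ cong (degree G ℓ +_) (sumFin-distrib-+ {n} _ _) ⟩
  degree G ℓ + (sumFin (λ i → b2n (adj G (punchIn ℓ i) ℓ)) + sumFin (degree (removeVertex G ℓ)))
    ≡⟨ +-assoc (degree G ℓ) _ _ ⟨
  degree G ℓ + sumFin (λ i → b2n (adj G (punchIn ℓ i) ℓ)) + sumFin (degree (removeVertex G ℓ))
    ≡⟨ cong (λ s → degree G ℓ + s + sumFin (degree (removeVertex G ℓ))) edges-at-ℓ ⟩
  degree G ℓ + degree G ℓ + sumFin (degree (removeVertex G ℓ))  ∎
  where
  open ≡-Reasoning
  edges-at-ℓ : sumFin (λ i → b2n (adj G (punchIn ℓ i) ℓ)) ≡ degree G ℓ
  edges-at-ℓ = begin
    sumFin (λ i → b2n (adj G (punchIn ℓ i) ℓ))       ≡⟨ sumFin-cong {n} (λ i → cong b2n (Graph.sym G (punchIn ℓ i) ℓ)) ⟩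
    sumFin (b2n ∘ adj G ℓ ∘ punchIn ℓ)               ≡⟨ cong (_+ sumFin (b2n ∘ adj G ℓ ∘ punchIn ℓ)) (cong b2n (irrefl G ℓ)) ⟨
    b2n (adj G ℓ ℓ) + sumFin (b2n ∘ adj G ℓ ∘ punchIn ℓ) ≡⟨ sumFin-remove (b2n ∘ adj G ℓ) ℓ ⟨
    degree G ℓ                                       ∎

acyclic⇒sum-degree+2≤ : ∀ n (G : Graph (suc n)) → Acyclic G → sumFin (degree G) + 2 ≤ 2 * suc n
acyclic⇒sum-degree+2≤ zero    G _ rewrite irrefl G Fin.zero = s≤s (s≤s z≤n)
acyclic⇒sum-degree+2≤ (suc n) G acyclic with acyclic⇒leaf G acyclic
... | ℓ , leaf = begin
  sumFin (degree G) + 2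
    ≡⟨ cong (_+ 2) (sum-degree-removeVertex G ℓ) ⟩
  degree G ℓ + degree G ℓ + sumFin (degree (removeVertex G ℓ)) + 2
    ≤⟨ +-monoˡ-≤ 2 (+-monoˡ-≤ _ (+-mono-≤ leaf leaf)) ⟩
  2 + (sumFin (degree (removeVertex G ℓ)) + 2)
    ≤⟨ +-monoʳ-≤ 2 (acyclic⇒sum-degree+2≤ n (removeVertex G ℓ) (Acyclic-removeVertex G ℓ acyclic)) ⟩
  2 + 2 * suc n
    ≡⟨ solve 1 (λ n → con 2 :+ con 2 :* (con 1 :+ n) := con 2 :* (con 1 :+ (con 1 :+ n))) refl n ⟩
  2 * suc (suc n)  ∎
  where open ≤-Reasoning

-- Perfect matchings as pairings of the vertex set

injective⇒surjective : ∀ {n} (f : Fin n → Fin n) → (∀ i j → f i ≡ f j → i ≡ j) → ∀ y → ∃ λ x → f x ≡ y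
injective⇒surjective {suc n} f f-inj y with any? (λ x → f x Fin.≟ y)
... | yes hit = hit
... | no miss = ⊥-elim (<-irrefl refl (injective⇒≤ {f = g} (λ {i} {j} eq →
                  f-inj i j (punchOut-injective (y≢f i) (y≢f j) eq))))
  where
  y≢f : ∀ i → y ≢ f i
  y≢f i y≡fi = miss (i , sym y≡fi)
  g : Fin (suc n) → Fin n
  g i = punchOut (y≢f i)

injective⇒↔ : ∀ {n} (f : Fin n → Fin n) → (∀ i j → f i ≡ f j → i ≡ j) → Fin n ↔ Fin n
injective⇒↔ f f-inj = mk↔ₛ′ f (proj₁ ∘ surj) (proj₂ ∘ surj) (λ x → f-inj _ _ (proj₂ (surj (f x))))
  where
  surj : ∀ y → ∃ λ x → f x ≡ y
  surj = injective⇒surjective f f-inj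

record PerfectMatching {n} (G : Graph n) (m : ℕ) (p q : ℕ → Fin n) : Set where
  field
    edge        : ∀ k → k < m → adj G (p k) (q k) ≡ true
    p-injective : ∀ i j → i < m → j < m → p i ≡ p j → i ≡ j
    q-injective : ∀ i j → i < m → j < m → q i ≡ q j → i ≡ j
    p≢q         : ∀ i j → i < m → j < m → p i ≢ q j
    cover       : ∀ v → ∃ λ k → k < m × (v ≡ p k ⊎ v ≡ q k)

listing : ∀ {n} → ℕ → (ℕ → Fin n) → (ℕ → Fin n) → ℕ → Fin n
listing m p q k with k <? m
... | yes _ = p k
... | no  _ = q (k ∸ m)

module _ {n} (m : ℕ) (p q : ℕ → Fin n) where

  listing-< : ∀ k → k < m → listing m p q k ≡ p k
  listing-< k k<m with k <? m
  ... | yes _   = refl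
  ... | no  k≮m = ⊥-elim (k≮m k<m)

  listing-≮ : ∀ k → ¬ k < m → listing m p q k ≡ q (k ∸ m)
  listing-≮ k k≮m with k <? m
  ... | yes k<m = ⊥-elim (k≮m k<m)
  ... | no  _   = refl

  listing-+ : ∀ j → listing m p q (m + j) ≡ q j
  listing-+ j = trans (listing-≮ (m + j) (λ m+j<m → <⇒≱ m+j<m (m≤m+n m j))) (cong q (m+n∸m≡n m j))

module PerfectMatchingSum {m : ℕ} {G : Graph (2 * m)} {p q : ℕ → Fin (2 * m)} (M : PerfectMatching G m p q) where
  open PerfectMatching M

  enumerate : Fin (2 * m) → Fin (2 * m)
  enumerate = listing m p q ∘ toℕ

  private
    2m≡m+m : 2 * m ≡ m + m
    2m≡m+m = cong (m +_) (+-identityʳ m)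

    upper-half : ∀ (i : Fin (2 * m)) → ¬ toℕ i < m → toℕ i ≡ m + (toℕ i ∸ m)
    upper-half i i≮m = sym (m+[n∸m]≡n (≮⇒≥ i≮m))

    upper-half-< : ∀ (i : Fin (2 * m)) → ¬ toℕ i < m → toℕ i ∸ m < m
    upper-half-< i i≮m = +-cancelˡ-< m _ _ (subst (_< m + m) (upper-half i i≮m) (subst (toℕ i <_) 2m≡m+m (toℕ<n i)))

  enumerate-injective : ∀ i j → enumerate i ≡ enumerate j → i ≡ j
  enumerate-injective i j eq with toSum (toℕ i <? m) | toSum (toℕ j <? m)
  ... | inj₁ i<m | inj₁ j<m = toℕ-injective (p-injective _ _ i<m j<m
        (trans (sym (listing-< m p q _ i<m)) (trans eq (listing-< m p q _ j<m))))
  ... | inj₂ i≮m | inj₂ j≮m = toℕ-injective (begin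
        toℕ i                ≡⟨ upper-half i i≮m ⟩
        m + (toℕ i ∸ m)      ≡⟨ cong (m +_) (q-injective _ _ (upper-half-< i i≮m) (upper-half-< j j≮m)
                                  (trans (sym (listing-≮ m p q _ i≮m)) (trans eq (listing-≮ m p q _ j≮m)))) ⟩
        m + (toℕ j ∸ m)      ≡⟨ upper-half j j≮m ⟨
        toℕ j                ∎)
        where open ≡-Reasoning
  ... | inj₁ i<m | inj₂ j≮m = ⊥-elim (p≢q _ _ i<m (upper-half-< j j≮m)
        (trans (sym (listing-< m p q _ i<m)) (trans eq (listing-≮ m p q _ j≮m))))
  ... | inj₂ i≮m | inj₁ j<m = ⊥-elim (p≢q _ _ j<m (upper-half-< i i≮m)
        (trans (sym (listing-< m p q _ j<m)) (trans (sym eq) (listing-≮ m p q _ i≮m))))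

  sumFin-matched : (f : Fin (2 * m) → ℕ) → sumFin f ≡ sumBelow m (λ k → f (p k) + f (q k))
  sumFin-matched f = begin
    sumFin f
      ≡⟨ sumFin-permute (injective⇒↔ enumerate enumerate-injective) f ⟨
    sumFin {2 * m} (f ∘ listing m p q ∘ toℕ)
      ≡⟨ sumFin-toℕ (2 * m) (f ∘ listing m p q) ⟩
    sumBelow (2 * m) (f ∘ listing m p q)
      ≡⟨ cong (λ n → sumBelow n (f ∘ listing m p q)) 2m≡m+m ⟩
    sumBelow (m + m) (f ∘ listing m p q)
      ≡⟨ sumBelow-+ m m _ ⟩
    sumBelow m (f ∘ listing m p q) + sumBelow m (λ j → f (listing m p q (m + j)))
      ≡⟨ cong₂ _+_ (sumBelow-cong m (λ k k<m → cong f (listing-< m p q k k<m)))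
                   (sumBelow-cong m (λ j _ → cong f (listing-+ m p q j))) ⟩
    sumBelow m (f ∘ p) + sumBelow m (f ∘ q)
      ≡⟨ sumBelow-distrib-+ m _ _ ⟨
    sumBelow m (λ k → f (p k) + f (q k))  ∎
    where open ≡-Reasoning

nth : ∀ {A : Set} → List A → A → ℕ → A
nth []       d _       = d
nth (x ∷ xs) d zero    = x
nth (x ∷ xs) d (suc k) = nth xs d k

module _ {n : ℕ} (d : Fin n × Fin n) where

  nth-endpoints : ∀ M k → k < length M → proj₁ (nth M d k) ∈ endpoints M × proj₂ (nth M d k) ∈ endpoints M
  nth-endpoints (_ ∷ _) zero    _         = here refl , there (here refl)
  nth-endpoints (_ ∷ M) (suc k) (s<s k<) =
    let u∈ , v∈ = nth-endpoints M k k< in there (there u∈) , there (there v∈)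

  ∈-endpoints : ∀ {v} M → v ∈ endpoints M → ∃ λ k → k < length M × (v ≡ proj₁ (nth M d k) ⊎ v ≡ proj₂ (nth M d k))
  ∈-endpoints (_ ∷ _) (here v≡u)         = 0 , z<s , inj₁ v≡u
  ∈-endpoints (_ ∷ _) (there (here v≡w)) = 0 , z<s , inj₂ v≡w
  ∈-endpoints (_ ∷ M) (there (there v∈)) =
    let k , k< , v≡ = ∈-endpoints M v∈ in suc k , s<s k< , v≡

  private
    fst snd : List (Fin n × Fin n) → ℕ → Fin n
    fst M k = proj₁ (nth M d k)
    snd M k = proj₂ (nth M d k)

  Unique-endpoints⇒fst-injective : ∀ M → Unique (endpoints M) → ∀ i j → i < length M → j < length M →
                                   fst M i ≡ fst M j → i ≡ j
  Unique-endpoints⇒fst-injective (_ ∷ _) _ zero zero _ _ _ = refl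
  Unique-endpoints⇒fst-injective (_ ∷ M) (u∉ ∷ _) zero (suc j) _ (s<s j<) eq =
    ⊥-elim (All.lookup u∉ (there (proj₁ (nth-endpoints M j j<))) eq)
  Unique-endpoints⇒fst-injective (_ ∷ M) (u∉ ∷ _) (suc i) zero (s<s i<) _ eq =
    ⊥-elim (All.lookup u∉ (there (proj₁ (nth-endpoints M i i<))) (sym eq))
  Unique-endpoints⇒fst-injective (_ ∷ M) (_ ∷ _ ∷ unique) (suc i) (suc j) (s<s i<) (s<s j<) eq =
    cong suc (Unique-endpoints⇒fst-injective M unique i j i< j< eq)

  Unique-endpoints⇒snd-injective : ∀ M → Unique (endpoints M) → ∀ i j → i < length M → j < length M →
                                   snd M i ≡ snd M j → i ≡ j
  Unique-endpoints⇒snd-injective (_ ∷ _) _ zero zero _ _ _ = refl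
  Unique-endpoints⇒snd-injective (_ ∷ M) (_ ∷ v∉ ∷ _) zero (suc j) _ (s<s j<) eq =
    ⊥-elim (All.lookup v∉ (proj₂ (nth-endpoints M j j<)) eq)
  Unique-endpoints⇒snd-injective (_ ∷ M) (_ ∷ v∉ ∷ _) (suc i) zero (s<s i<) _ eq =
    ⊥-elim (All.lookup v∉ (proj₂ (nth-endpoints M i i<)) (sym eq))
  Unique-endpoints⇒snd-injective (_ ∷ M) (_ ∷ _ ∷ unique) (suc i) (suc j) (s<s i<) (s<s j<) eq =
    cong suc (Unique-endpoints⇒snd-injective M unique i j i< j< eq)

  Unique-endpoints⇒fst≢snd : ∀ M → Unique (endpoints M) → ∀ i j → i < length M → j < length M → fst M i ≢ snd M j
  Unique-endpoints⇒fst≢snd (_ ∷ _) (u∉ ∷ _) zero zero _ _ = All.lookup u∉ (here refl)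
  Unique-endpoints⇒fst≢snd (_ ∷ M) (u∉ ∷ _) zero (suc j) _ (s<s j<) =
    All.lookup u∉ (there (proj₂ (nth-endpoints M j j<)))
  Unique-endpoints⇒fst≢snd (_ ∷ M) (_ ∷ v∉ ∷ _) (suc i) zero (s<s i<) _ =
    All.lookup v∉ (proj₁ (nth-endpoints M i i<)) ∘ sym
  Unique-endpoints⇒fst≢snd (_ ∷ M) (_ ∷ _ ∷ unique) (suc i) (suc j) (s<s i<) (s<s j<) =
    Unique-endpoints⇒fst≢snd M unique i j i< j<

All-nth : ∀ {A : Set} {P : A → Set} {xs : List A} d → All P xs → ∀ k → k < length xs → P (nth xs d k)
All-nth d (px ∷ _)   zero    _        = px
All-nth d (_ ∷ pxs) (suc k) (s<s k<) = All-nth d pxs k k<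

Unique-full : ∀ {n} {xs : List (Fin n)} → Unique xs → n ≤ length xs → ∀ v → v ∈ xs
Unique-full {n} {xs} unique n≤ v with v ∈? xs
  where open DecMembership (Fin._≟_ {n}) using (_∈?_)
... | yes v∈ = v∈
... | no  v∉ = ⊥-elim (<⇒≱ (s≤s n≤) (Unique⇒length≤ {xs = v ∷ xs} (¬Any⇒All¬ xs v∉ ∷ unique)))

matching⇒PerfectMatching : ∀ {m} (G : Graph (2 * m)) d M → IsMatching G M → length M ≡ m →
  PerfectMatching G m (λ k → proj₁ (nth M d k)) (λ k → proj₂ (nth M d k))
matching⇒PerfectMatching {m} G d M (edges , unique) |M|≡m = record
  { edge        = λ k k<m → All-nth d edges k (<m⇒<|M| k<m)
  ; p-injective = λ i j i<m j<m → Unique-endpoints⇒fst-injective d M unique i j (<m⇒<|M| i<m) (<m⇒<|M| j<m)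
  ; q-injective = λ i j i<m j<m → Unique-endpoints⇒snd-injective d M unique i j (<m⇒<|M| i<m) (<m⇒<|M| j<m)
  ; p≢q         = λ i j i<m j<m → Unique-endpoints⇒fst≢snd d M unique i j (<m⇒<|M| i<m) (<m⇒<|M| j<m)
  ; cover       = λ v → let k , k< , v≡ = ∈-endpoints d M (Unique-full unique 2m≤ v) in k , <|M|⇒<m k< , v≡
  }
  where
  <m⇒<|M| : ∀ {k} → k < m → k < length M
  <m⇒<|M| = subst (_ <_) (sym |M|≡m)
  <|M|⇒<m : ∀ {k} → k < length M → k < m
  <|M|⇒<m = subst (_ <_) |M|≡m
  length-endpoints : ∀ M′ → length (endpoints M′) ≡ 2 * length M′
  length-endpoints []      = refl
  length-endpoints (_ ∷ M′) = trans (cong (suc ∘ suc) (length-endpoints M′)) (cong suc (sym (+-suc (length M′) _)))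
  2m≤ : 2 * m ≤ length (endpoints M)
  2m≤ = ≤-reflexive (sym (trans (length-endpoints M) (cong (2 *_) |M|≡m)))

orient : ∀ {n} → (ℕ → Bool) → (ℕ → Fin n) → (ℕ → Fin n) → ℕ → Fin n
orient flip p q k = if flip k then q k else p k

PerfectMatching-orient : ∀ {n} {G : Graph n} {m p q} → PerfectMatching G m p q → (flip : ℕ → Bool) →
                         PerfectMatching G m (orient flip p q) (orient flip q p)
PerfectMatching-orient {G = G} {m} {p} {q} M flip = record
  { edge = edge′ ; p-injective = p′-injective ; q-injective = q′-injective ; p≢q = p′≢q′ ; cover = cover′ }
  where
  open PerfectMatching M
  edge′ : ∀ k → k < m → adj G (orient flip p q k) (orient flip q p k) ≡ true
  edge′ k k<m with flip k
  ... | true  = adj-sym G (edge k k<m)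
  ... | false = edge k k<m
  p′-injective : ∀ i j → i < m → j < m → orient flip p q i ≡ orient flip p q j → i ≡ j
  p′-injective i j i<m j<m eq with flip i | flip j
  ... | true  | true  = q-injective i j i<m j<m eq
  ... | false | false = p-injective i j i<m j<m eq
  ... | true  | false = ⊥-elim (p≢q j i j<m i<m (sym eq))
  ... | false | true  = ⊥-elim (p≢q i j i<m j<m eq)
  q′-injective : ∀ i j → i < m → j < m → orient flip q p i ≡ orient flip q p j → i ≡ j
  q′-injective i j i<m j<m eq with flip i | flip j
  ... | true  | true  = p-injective i j i<m j<m eq
  ... | false | false = q-injective i j i<m j<m eq
  ... | true  | false = ⊥-elim (p≢q i j i<m j<m eq)
  ... | false | true  = ⊥-elim (p≢q j i j<m i<m (sym eq))
  p′≢q′ : ∀ i j → i < m → j < m → orient flip p q i ≢ orient flip q p j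
  p′≢q′ i j i<m j<m eq with flip i in fi | flip j in fj
  ... | true  | true  = p≢q j i j<m i<m (sym eq)
  ... | false | false = p≢q i j i<m j<m eq
  ... | true  | false = true≢false (trans (sym fi) (subst (λ k → flip k ≡ false) (sym (q-injective i j i<m j<m eq)) fj))
  ... | false | true  = true≢false (trans (sym fj) (subst (λ k → flip k ≡ false) (p-injective i j i<m j<m eq) fi))
  cover′ : ∀ v → ∃ λ k → k < m × (v ≡ orient flip p q k ⊎ v ≡ orient flip q p k)
  cover′ v with cover v
  ... | k , k<m , v≡pq = k , k<m , reorient k v≡pq
    where
    reorient : ∀ {v} k → v ≡ p k ⊎ v ≡ q k → v ≡ orient flip p q k ⊎ v ≡ orient flip q p k
    reorient k v≡pq with flip k | v≡pq
    ... | true  | inj₁ v≡p = inj₂ v≡p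
    ... | true  | inj₂ v≡q = inj₁ v≡q
    ... | false | v≡pq′    = v≡pq′

PerfectMatching-reindex : ∀ {n} {G : Graph n} {m p q} → PerfectMatching G m p q → (τ : ℕ → ℕ) →
  (∀ k → k < m → τ k < m) → (∀ k → k < m → τ (τ k) ≡ k) → PerfectMatching G m (p ∘ τ) (q ∘ τ)
PerfectMatching-reindex {m = m} {p} {q} M τ τ-< τ-involutive = record
  { edge        = λ k k<m → edge (τ k) (τ-< k k<m)
  ; p-injective = λ i j i<m j<m → τ-injective i<m j<m ∘ p-injective (τ i) (τ j) (τ-< i i<m) (τ-< j j<m)
  ; q-injective = λ i j i<m j<m → τ-injective i<m j<m ∘ q-injective (τ i) (τ j) (τ-< i i<m) (τ-< j j<m)
  ; p≢q         = λ i j i<m j<m → p≢q (τ i) (τ j) (τ-< i i<m) (τ-< j j<m)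
  ; cover       = cover′
  }
  where
  open PerfectMatching M
  τ-injective : ∀ {i j} → i < m → j < m → τ i ≡ τ j → i ≡ j
  τ-injective {i} {j} i<m j<m eq = trans (sym (τ-involutive i i<m)) (trans (cong τ eq) (τ-involutive j j<m))
  cover′ : ∀ v → ∃ λ k → k < m × (v ≡ p (τ k) ⊎ v ≡ q (τ k))
  cover′ v with cover v
  ... | k , k<m , inj₁ v≡p = τ k , τ-< k k<m , inj₁ (trans v≡p (cong p (sym (τ-involutive k k<m))))
  ... | k , k<m , inj₂ v≡q = τ k , τ-< k k<m , inj₂ (trans v≡q (cong q (sym (τ-involutive k k<m))))

swap₀ : ℕ → ℕ → ℕ
swap₀ i zero    = i
swap₀ i (suc k) with suc k ≟ i
... | yes _ = 0
... | no  _ = suc k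

swap₀-< : ∀ {m i} → i < m → ∀ k → k < m → swap₀ i k < m
swap₀-< i<m zero    _   = i<m
swap₀-< {i = i} i<m (suc k) k<m with suc k ≟ i
... | yes _ = ≤-trans (s≤s z≤n) k<m
... | no  _ = k<m

swap₀-self : ∀ i → swap₀ i i ≡ 0
swap₀-self zero    = refl
swap₀-self (suc i) with suc i ≟ suc i
... | yes _   = refl
... | no  i≢i = ⊥-elim (i≢i refl)

swap₀-involutive : ∀ i k → swap₀ i (swap₀ i k) ≡ k
swap₀-involutive i zero = swap₀-self i
swap₀-involutive i (suc k) with suc k ≟ i
... | yes k≡i = sym k≡i
... | no  k≢i with suc k ≟ i
...   | yes k≡i = ⊥-elim (k≢i k≡i)
...   | no  _   = refl

swap₀≡⇒ : ∀ i k → swap₀ i k ≡ i → k ≡ 0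
swap₀≡⇒ i k eq = trans (sym (swap₀-involutive i k)) (trans (cong (swap₀ i) eq) (swap₀-self i))

walk-exits : ∀ {n} (G : Graph n) (S : Fin n → Set) → (∀ x → Dec (S x)) → ∀ {u w} → Walk G u w → S u → ¬ S w →
             ∃₂ λ x y → S x × ¬ S y × adj G x y ≡ true
walk-exits G S S? here                    u∈S w∉S = ⊥-elim (w∉S u∈S)
walk-exits G S S? (step {u} {v} uv walk) u∈S w∉S with S? v
... | yes v∈S = walk-exits G S S? walk v∈S w∉S
... | no  v∉S = u , v , u∈S , v∉S , uv

other-index : ∀ {m} k → 2 ≤ m → ∃ λ k′ → k′ < m × k′ ≢ k
other-index zero    2≤m = 1 , 2≤m , λ ()
other-index (suc k) 2≤m = 0 , ≤-trans (s≤s z≤n) 2≤m , λ ()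

module _ {m : ℕ} {G : Graph (2 * m)} {p q : ℕ → Fin (2 * m)} (M : PerfectMatching G m p q) where
  open PerfectMatching M

  p-degree≥1 : ∀ k → k < m → 1 ≤ degree G (p k)
  p-degree≥1 k k<m = adj⇒degree≥1 G (edge k k<m)

  q-degree≥1 : ∀ k → k < m → 1 ≤ degree G (q k)
  q-degree≥1 k k<m = adj⇒degree≥1 G (adj-sym G (edge k k<m))

  -- A walk from p k to a vertex of another pair leaves {p k, q k} along an edge,
  -- which is a second edge at p k or at q k.
  connected⇒pair-degree≥3 : Connected G → 2 ≤ m → ∀ k → k < m → 3 ≤ degree G (p k) + degree G (q k)
  connected⇒pair-degree≥3 connected 2≤m k k<m with other-index k 2≤m
  ... | k′ , k′<m , k′≢k = exit-degrees (walk-exits G InPair inPair? (connected (p k) (p k′)) (inj₁ refl) p-k′∉pair)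
    where
    InPair : Fin (2 * m) → Set
    InPair x = x ≡ p k ⊎ x ≡ q k

    inPair? : ∀ x → Dec (InPair x)
    inPair? x = x Fin.≟ p k ⊎-dec x Fin.≟ q k

    p-k′∉pair : ¬ InPair (p k′)
    p-k′∉pair (inj₁ p≡p) = k′≢k (p-injective k′ k k′<m k<m p≡p)
    p-k′∉pair (inj₂ p≡q) = p≢q k′ k k′<m k<m p≡q

    exit-degrees : ∃₂ (λ x y → InPair x × ¬ InPair y × adj G x y ≡ true) → 3 ≤ degree G (p k) + degree G (q k)
    exit-degrees (_ , y , inj₁ refl , y∉pair , py) =
      +-mono-≤ (two-neighbours⇒degree≥2 G (edge k k<m) py (λ q≡y → y∉pair (inj₂ (sym q≡y)))) (q-degree≥1 k k<m)
    exit-degrees (_ , y , inj₂ refl , y∉pair , qy) = subst (_≤ degree G (p k) + degree G (q k)) (+-comm 1 2)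
      (+-mono-≤ (p-degree≥1 k k<m) (two-neighbours⇒degree≥2 G (adj-sym G (edge k k<m)) qy (λ p≡y → y∉pair (inj₁ (sym p≡y)))))

-- The tree T_{2m,m}

data StarEdge (n m : ℕ) : ℕ → ℕ → Set where
  spoke   : ∀ {b} → 1 ≤ b → b ≤ n ∸ m → StarEdge n m 0 b
  pendant : ∀ {a} → 1 ≤ a → a ≤ m ∸ 1 → StarEdge n m a (n ∸ m + a)

Tadjℕ⇒StarEdge : ∀ n m a b → Tadjℕ n m a b ≡ true → StarEdge n m a b
Tadjℕ⇒StarEdge n m a b adj with Equivalence.to (Boolₚ.T-∨ {(a ≡ᵇ 0) ∧ (1 ≤ᵇ b) ∧ (b ≤ᵇ n ∸ m)}) (subst Tᵇ (sym adj) tt)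
... | inj₁ spoke? with Equivalence.to (Boolₚ.T-∧ {a ≡ᵇ 0}) spoke?
...   | a≡0 , bounds with ≡ᵇ⇒≡ a 0 a≡0 | Equivalence.to (Boolₚ.T-∧ {1 ≤ᵇ b}) bounds
...     | refl | 1≤b , b≤ = spoke (≤ᵇ⇒≤ 1 b 1≤b) (≤ᵇ⇒≤ b (n ∸ m) b≤)
Tadjℕ⇒StarEdge n m a b adj | inj₂ pendant? with Equivalence.to (Boolₚ.T-∧ {1 ≤ᵇ a}) pendant?
...   | 1≤a , rest with Equivalence.to (Boolₚ.T-∧ {a ≤ᵇ m ∸ 1}) rest
...     | a≤ , b≡ with ≡ᵇ⇒≡ b (n ∸ m + a) b≡
...       | refl = pendant (≤ᵇ⇒≤ 1 a 1≤a) (≤ᵇ⇒≤ a (m ∸ 1) a≤)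

StarEdge⇒Tadjℕ : ∀ {n m a b} → StarEdge n m a b → Tadjℕ n m a b ≡ true
StarEdge⇒Tadjℕ (spoke 1≤b b≤) rewrite Tᵇ⇒≡true (≤⇒≤ᵇ 1≤b) | Tᵇ⇒≡true (≤⇒≤ᵇ b≤) = refl
StarEdge⇒Tadjℕ {n} {m} {suc a} (pendant (s≤s z≤n) a≤)
  rewrite Tᵇ⇒≡true (≤⇒≤ᵇ a≤) | Tᵇ⇒≡true (≡⇒≡ᵇ (n ∸ m + suc a) (n ∸ m + suc a) refl) = refl

2*m∸m≡m : ∀ m → 2 * m ∸ m ≡ m
2*m∸m≡m m = trans (m+n∸m≡n m (m + 0)) (+-identityʳ m)

-- In T_{2m,m}: centre 0, inner vertices 1,…,m-1, the leaf m at the centre, and the outer leaf m+k at k.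
data Label (m a : ℕ) : Set where
  centre : a ≡ 0 → Label m a
  inner  : ∀ k → 1 ≤ k → k < m → a ≡ k → Label m a
  tip    : a ≡ m → Label m a
  outer  : ∀ k → 1 ≤ k → k < m → a ≡ m + k → Label m a

label : ∀ m a → a < 2 * m → Label m a
label m zero    _ = centre refl
label m (suc a) a<2m with suc a <? m | suc a ≟ m
... | yes a<m | _       = inner (suc a) (s≤s z≤n) a<m refl
... | no _    | yes a≡m = tip a≡m
... | no a≮m  | no a≢m  = outer (suc a ∸ m) (m<n⇒0<n∸m m<a) (+-cancelˡ-< m _ _ (begin-strict
    m + (suc a ∸ m)   ≡⟨ m+[n∸m]≡n (≮⇒≥ a≮m) ⟩
    suc a             <⟨ a<2m ⟩
    2 * m             ≡⟨ cong (m +_) (+-identityʳ m) ⟩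
    m + m             ∎))
    (sym (m+[n∸m]≡n (≮⇒≥ a≮m)))
  where
  open ≤-Reasoning
  m<a : m < suc a
  m<a = ≤∧≢⇒< (≮⇒≥ a≮m) (a≢m ∘ sym)

labelAdj : ∀ {m a b} → Label m a → Label m b → Bool
labelAdj (centre _)      (inner _ _ _ _) = true
labelAdj (centre _)      (tip _)         = true
labelAdj (inner _ _ _ _) (centre _)      = true
labelAdj (tip _)         (centre _)      = true
labelAdj (inner k _ _ _) (outer l _ _ _) = k ≡ᵇ l
labelAdj (outer k _ _ _) (inner l _ _ _) = l ≡ᵇ k
labelAdj _               _               = false

labelAdj-sym : ∀ {m a b} (la : Label m a) (lb : Label m b) → labelAdj la lb ≡ labelAdj lb la
labelAdj-sym (centre _)      (centre _)      = refl
labelAdj-sym (centre _)      (inner _ _ _ _) = refl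
labelAdj-sym (centre _)      (tip _)         = refl
labelAdj-sym (centre _)      (outer _ _ _ _) = refl
labelAdj-sym (inner _ _ _ _) (centre _)      = refl
labelAdj-sym (inner _ _ _ _) (inner _ _ _ _) = refl
labelAdj-sym (inner _ _ _ _) (tip _)         = refl
labelAdj-sym (inner _ _ _ _) (outer _ _ _ _) = refl
labelAdj-sym (tip _)         (centre _)      = refl
labelAdj-sym (tip _)         (inner _ _ _ _) = refl
labelAdj-sym (tip _)         (tip _)         = refl
labelAdj-sym (tip _)         (outer _ _ _ _) = refl
labelAdj-sym (outer _ _ _ _) (centre _)      = refl
labelAdj-sym (outer _ _ _ _) (inner _ _ _ _) = refl
labelAdj-sym (outer _ _ _ _) (tip _)         = refl
labelAdj-sym (outer _ _ _ _) (outer _ _ _ _) = refl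

≤∸1⇒< : ∀ {a m} → 1 ≤ a → a ≤ m ∸ 1 → a < m
≤∸1⇒< {m = zero}  (s≤s _) ()
≤∸1⇒< {m = suc m} _ a≤m = s≤s a≤m

<⇒≤∸1 : ∀ {a m} → a < m → a ≤ m ∸ 1
<⇒≤∸1 (s≤s a≤m) = a≤m

StarEdge⇒labelAdj : ∀ {m a b} → StarEdge (2 * m) m a b → (la : Label m a) (lb : Label m b) → labelAdj la lb ≡ true
StarEdge⇒labelAdj (spoke _ _) (centre _) (inner _ _ _ _) = refl
StarEdge⇒labelAdj (spoke _ _) (centre _) (tip _)         = refl
StarEdge⇒labelAdj (spoke 1≤b _) (centre _) (centre b≡0) = ⊥-elim (>⇒≢ 1≤b b≡0)
StarEdge⇒labelAdj {m} (spoke _ b≤) (centre _) (outer k 1≤k _ refl) =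
  ⊥-elim (<⇒≱ (m<m+n m 1≤k) (subst (m + k ≤_) (2*m∸m≡m m) b≤))
StarEdge⇒labelAdj (spoke _ _) (inner k 1≤k _ 0≡k) _ = ⊥-elim (>⇒≢ 1≤k (sym 0≡k))
StarEdge⇒labelAdj {m} {b = b} (spoke 1≤b b≤) (tip 0≡m) _ =
  ⊥-elim (<⇒≱ 1≤b (subst (b ≤_) (trans (2*m∸m≡m m) (sym 0≡m)) b≤))
StarEdge⇒labelAdj {m} (spoke _ _) (outer k 1≤k _ 0≡m+k) _ = ⊥-elim (>⇒≢ 1≤k (m+n≡0⇒n≡0 m (sym 0≡m+k)))
StarEdge⇒labelAdj (pendant 1≤a _) (centre a≡0) _ = ⊥-elim (>⇒≢ 1≤a a≡0)
StarEdge⇒labelAdj {m} {a} (pendant 1≤a _) (inner a 1≤a′ a<m refl) lb = only-outer lb (cong (_+ a) (2*m∸m≡m m))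
  where
  only-outer : ∀ {b} (lb : Label m b) → b ≡ m + a → labelAdj (inner a 1≤a′ a<m refl) lb ≡ true
  only-outer (centre refl)           m+a≡0 = ⊥-elim (>⇒≢ 1≤a (m+n≡0⇒n≡0 m (sym m+a≡0)))
  only-outer (inner l _ l<m refl)    l≡m+a = ⊥-elim (<⇒≱ l<m (subst (m ≤_) (sym l≡m+a) (m≤m+n m a)))
  only-outer (tip refl)              m≡m+a = ⊥-elim (>⇒≢ 1≤a (+-cancelˡ-≡ m a 0 (trans (sym m≡m+a) (sym (+-identityʳ m)))))
  only-outer (outer l _ _ refl)      m+l≡m+a = Tᵇ⇒≡true (≡⇒≡ᵇ a l (+-cancelˡ-≡ m a l (sym m+l≡m+a)))
StarEdge⇒labelAdj (pendant 1≤a a≤) (tip refl) _ = ⊥-elim (<-irrefl refl (≤∸1⇒< 1≤a a≤))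
StarEdge⇒labelAdj {m} (pendant _ a≤) (outer k 1≤k _ refl) _ =
  ⊥-elim (<⇒≱ (m<m+n m 1≤k) (≤-trans a≤ (m∸n≤m m 1)))

module _ {n m : ℕ} where

  Tadjℕ-false : ∀ {a b} → ¬ StarEdge n m a b → Tadjℕ n m a b ≡ false
  Tadjℕ-false {a} {b} ¬ab = ¬Tᵇ⇒≡false (¬ab ∘ Tadjℕ⇒StarEdge n m a b ∘ Tᵇ⇒≡true)

  TadjSym-true : ∀ {a b} → a ≢ b → StarEdge n m a b ⊎ StarEdge n m b a → TadjSym n m a b ≡ true
  TadjSym-true {a} {b} a≢b edge rewrite ¬Tᵇ⇒≡false (a≢b ∘ ≡ᵇ⇒≡ a b) with edge
  ... | inj₁ ab rewrite StarEdge⇒Tadjℕ ab = refl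
  ... | inj₂ ba rewrite StarEdge⇒Tadjℕ ba = Boolₚ.∨-zeroʳ _

  TadjSym-false : ∀ {a b} → ¬ StarEdge n m a b → ¬ StarEdge n m b a → TadjSym n m a b ≡ false
  TadjSym-false ¬ab ¬ba rewrite Tadjℕ-false ¬ab | Tadjℕ-false ¬ba = Boolₚ.∧-zeroʳ _

StarEdge⇒≢ : ∀ {m a b} → StarEdge (2 * m) m a b → a ≢ b
StarEdge⇒≢ (spoke 1≤b _) 0≡b = >⇒≢ 1≤b (sym 0≡b)
StarEdge⇒≢ {m} {a} (pendant 1≤a a≤) a≡ = <-irrefl a≡ (begin-strict
  a              <⟨ m<m+n a (≤-trans 1≤a (<⇒≤ (≤∸1⇒< 1≤a a≤))) ⟩
  a + m          ≡⟨ +-comm a m ⟩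
  m + a          ≡⟨ cong (_+ a) (2*m∸m≡m m) ⟨
  2 * m ∸ m + a  ∎)
  where open ≤-Reasoning

module _ {m : ℕ} (m≥1 : 1 ≤ m) where
  private
    spoke-to : ∀ {b} → 1 ≤ b → b ≤ m → StarEdge (2 * m) m 0 b
    spoke-to 1≤b b≤m = spoke 1≤b (subst (_ ≤_) (sym (2*m∸m≡m m)) b≤m)

    pendant-at : ∀ {k l} → 1 ≤ k → k < m → Tᵇ (k ≡ᵇ l) → StarEdge (2 * m) m k (m + l)
    pendant-at {k} {l} 1≤k k<m k≡ᵇl with ≡ᵇ⇒≡ k l k≡ᵇl
    ... | refl = subst (λ n → StarEdge (2 * m) m k (n + k)) (2*m∸m≡m m) (pendant 1≤k (<⇒≤∸1 k<m))

  labelAdj⇒StarEdge : ∀ {a b} (la : Label m a) (lb : Label m b) → labelAdj la lb ≡ true →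
                      StarEdge (2 * m) m a b ⊎ StarEdge (2 * m) m b a
  labelAdj⇒StarEdge (centre refl)         (inner _ 1≤k k<m refl) _   = inj₁ (spoke-to 1≤k (<⇒≤ k<m))
  labelAdj⇒StarEdge (centre refl)         (tip refl)             _   = inj₁ (spoke-to m≥1 ≤-refl)
  labelAdj⇒StarEdge (inner _ 1≤k k<m refl) (centre refl)          _   = inj₂ (spoke-to 1≤k (<⇒≤ k<m))
  labelAdj⇒StarEdge (tip refl)            (centre refl)          _   = inj₂ (spoke-to m≥1 ≤-refl)
  labelAdj⇒StarEdge (inner k 1≤k k<m refl) (outer l _ _ refl)    k≡l = inj₁ (pendant-at 1≤k k<m (subst Tᵇ (sym k≡l) tt))
  labelAdj⇒StarEdge (outer l _ _ refl)    (inner k 1≤k k<m refl) k≡l = inj₂ (pendant-at 1≤k k<m (subst Tᵇ (sym k≡l) tt))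
  labelAdj⇒StarEdge (centre _)      (centre _)      ()
  labelAdj⇒StarEdge (centre _)      (outer _ _ _ _) ()
  labelAdj⇒StarEdge (inner _ _ _ _) (inner _ _ _ _) ()
  labelAdj⇒StarEdge (inner _ _ _ _) (tip _)         ()
  labelAdj⇒StarEdge (tip _)         (inner _ _ _ _) ()
  labelAdj⇒StarEdge (tip _)         (tip _)         ()
  labelAdj⇒StarEdge (tip _)         (outer _ _ _ _) ()
  labelAdj⇒StarEdge (outer _ _ _ _) (centre _)      ()
  labelAdj⇒StarEdge (outer _ _ _ _) (tip _)         ()
  labelAdj⇒StarEdge (outer _ _ _ _) (outer _ _ _ _) ()

  TadjSym≡labelAdj : ∀ {a b} (la : Label m a) (lb : Label m b) → TadjSym (2 * m) m a b ≡ labelAdj la lb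
  TadjSym≡labelAdj {a} {b} la lb with labelAdj la lb in adjacent
  ... | true  = TadjSym-true ([ StarEdge⇒≢ , (λ ba → StarEdge⇒≢ ba ∘ sym) ] edge) edge
    where
    edge : StarEdge (2 * m) m a b ⊎ StarEdge (2 * m) m b a
    edge = labelAdj⇒StarEdge la lb adjacent
  ... | false = TadjSym-false
    (λ ab → true≢false (trans (sym (StarEdge⇒labelAdj ab la lb)) adjacent))
    (λ ba → true≢false (trans (sym (StarEdge⇒labelAdj ba lb la)) (trans (labelAdj-sym lb la) adjacent)))

module DegreesOfT (m′ : ℕ) where
  m : ℕ
  m = suc m′

  tAdj : ℕ → ℕ → ℕ
  tAdj a b = b2n (TadjSym (2 * m) m a b)

  tDegree : ℕ → ℕ
  tDegree a = sumBelow (2 * m) (tAdj a)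

  degree-T : ∀ v → degree (T (2 * m) m) v ≡ tDegree (toℕ v)
  degree-T v = sumFin-toℕ (2 * m) (tAdj (toℕ v))

  sumBelow-blocks : ∀ h → sumBelow (2 * m) h ≡ (h 0 + sumBelow m′ (h ∘ suc)) + (h (m + 0) + sumBelow m′ (λ j → h (m + suc j)))
  sumBelow-blocks h = trans (cong (λ n → sumBelow n h) (cong (m +_) (+-identityʳ m))) (sumBelow-+ m m h)

  centre₀ : Label m 0
  centre₀ = centre refl

  tip₀ : Label m (m + 0)
  tip₀ = tip (+-identityʳ m)

  innerAt : ∀ j → j < m′ → Label m (suc j)
  innerAt j j< = inner (suc j) (s≤s z≤n) (s<s j<) refl

  outerAt : ∀ j → j < m′ → Label m (m + suc j)
  outerAt j j< = outer (suc j) (s≤s z≤n) (s<s j<) refl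

  tAdj-label : ∀ {a b} (la : Label m a) (lb : Label m b) → tAdj a b ≡ b2n (labelAdj la lb)
  tAdj-label la lb = cong b2n (TadjSym≡labelAdj (s≤s z≤n) la lb)

  tDegree-blocks : ∀ {a} (la : Label m a) → tDegree a ≡
    (b2n (labelAdj la centre₀) + sumBelow m′ (tAdj a ∘ suc)) + (b2n (labelAdj la tip₀) + sumBelow m′ (λ j → tAdj a (m + suc j)))
  tDegree-blocks {a} la = trans (sumBelow-blocks (tAdj a))
    (cong₂ (λ x y → (x + _) + (y + _)) (tAdj-label la centre₀) (tAdj-label la tip₀))

  inner-block : ∀ {a} (la : Label m a) → (∀ j j< → labelAdj la (innerAt j j<) ≡ false) → sumBelow m′ (tAdj a ∘ suc) ≡ 0
  inner-block la none = sumBelow-zero m′ (λ j j< → trans (tAdj-label la (innerAt j j<)) (cong b2n (none j j<)))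

  outer-block : ∀ {a} (la : Label m a) → (∀ j j< → labelAdj la (outerAt j j<) ≡ false) → sumBelow m′ (λ j → tAdj a (m + suc j)) ≡ 0
  outer-block la none = sumBelow-zero m′ (λ j j< → trans (tAdj-label la (outerAt j j<)) (cong b2n (none j j<)))

  indicator-sum : ∀ {i} → i < m′ → (h : ℕ → ℕ) → (∀ j → j < m′ → h j ≡ b2n (i ≡ᵇ j)) → sumBelow m′ h ≡ 1
  indicator-sum {i} i< h h≡ = trans (sumBelow-single m′ h i< (λ j j< j≢i →
      trans (h≡ j j<) (cong b2n (¬Tᵇ⇒≡false (j≢i ∘ sym ∘ ≡ᵇ⇒≡ i j)))))
    (trans (h≡ i i<) (cong b2n (Tᵇ⇒≡true (≡⇒≡ᵇ i i refl))))

  tDegree-centre : tDegree 0 ≡ m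
  tDegree-centre = begin
    tDegree 0                            ≡⟨ tDegree-blocks centre₀ ⟩
    (0 + sumBelow m′ (tAdj 0 ∘ suc)) + (1 + sumBelow m′ (λ j → tAdj 0 (m + suc j)))
      ≡⟨ cong₂ (λ x y → x + (1 + y))
           (trans (sumBelow-cong m′ (λ j j< → tAdj-label centre₀ (innerAt j j<))) (trans (sumBelow-const m′ 1) (*-identityʳ m′)))
           (outer-block centre₀ (λ _ _ → refl)) ⟩
    m′ + 1                               ≡⟨ +-comm m′ 1 ⟩
    m                                    ∎
    where open ≡-Reasoning

  tDegree-inner : ∀ k → k < m′ → tDegree (suc k) ≡ 2
  tDegree-inner k k< = trans (tDegree-blocks lk) (cong₂ (λ x y → (1 + x) + y)
      (inner-block lk (λ _ _ → refl))
      (indicator-sum k< _ (λ j j< → tAdj-label lk (outerAt j j<))))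
    where lk = innerAt k k<

  tDegree-tip : tDegree (m + 0) ≡ 1
  tDegree-tip = trans (tDegree-blocks tip₀)
    (cong₂ (λ x y → (1 + x) + (0 + y)) (inner-block tip₀ (λ _ _ → refl)) (outer-block tip₀ (λ _ _ → refl)))

  tDegree-outer : ∀ k → k < m′ → tDegree (m + suc k) ≡ 1
  tDegree-outer k k< = trans (tDegree-blocks lk) (cong₂ (λ x y → x + (0 + y))
      (indicator-sum k< _ (λ j j< → trans (tAdj-label lk (innerAt j j<)) (cong b2n (≡ᵇ-sym (suc j) (suc k)))))
      (outer-block lk (λ _ _ → refl)))
    where lk = outerAt k k<

  sum-tDegree² : sumBelow (2 * m) (λ a → tDegree a * tDegree a) + 4 ≡ m * m + 5 * m
  sum-tDegree² = begin
    sumBelow (2 * m) (λ a → tDegree a * tDegree a) + 4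
      ≡⟨ cong (_+ 4) (sumBelow-blocks (λ a → tDegree a * tDegree a)) ⟩
    (tDegree 0 * tDegree 0 + sumBelow m′ (λ j → tDegree (suc j) * tDegree (suc j)))
      + (tDegree (m + 0) * tDegree (m + 0) + sumBelow m′ (λ j → tDegree (m + suc j) * tDegree (m + suc j))) + 4
      ≡⟨ cong (_+ 4) (cong₂ _+_
           (cong₂ _+_ (cong₂ _*_ tDegree-centre tDegree-centre)
                      (trans (sumBelow-cong m′ (λ j j< → cong₂ _*_ (tDegree-inner j j<) (tDegree-inner j j<))) (sumBelow-const m′ 4)))
           (cong₂ _+_ (cong₂ _*_ tDegree-tip tDegree-tip)
                      (trans (sumBelow-cong m′ (λ j j< → cong₂ _*_ (tDegree-outer j j<) (tDegree-outer j j<))) (sumBelow-const m′ 1)))) ⟩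
    (m * m + m′ * 4) + (1 * 1 + m′ * 1) + 4
      ≡⟨ solve 1 (λ x → ((con 1 :+ x) :* (con 1 :+ x) :+ x :* con 4) :+ (con 1 :* con 1 :+ x :* con 1) :+ con 4
                     := (con 1 :+ x) :* (con 1 :+ x) :+ con 5 :* (con 1 :+ x)) refl m′ ⟩
    m * m + 5 * m  ∎
    where open ≡-Reasoning

  M₁-T : M₁ (T (2 * m) m) + 4 ≡ m * m + 5 * m
  M₁-T = begin
    M₁ (T (2 * m) m) + 4                                        ≡⟨ cong (_+ 4) (M₁≡sum-degree² (T (2 * m) m)) ⟩
    sumFin (λ v → degree (T (2 * m) m) v * degree (T (2 * m) m) v) + 4
      ≡⟨ cong (_+ 4) (sumFin-cong {2 * m} (λ v → cong₂ _*_ (degree-T v) (degree-T v))) ⟩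
    sumFin {2 * m} (λ v → tDegree (toℕ v) * tDegree (toℕ v)) + 4  ≡⟨ cong (_+ 4) (sumFin-toℕ (2 * m) (λ a → tDegree a * tDegree a)) ⟩
    sumBelow (2 * m) (λ a → tDegree a * tDegree a) + 4          ≡⟨ sum-tDegree² ⟩
    m * m + 5 * m                                               ∎
    where open ≡-Reasoning

module _ {n : ℕ} {G H : Graph n} (G≅H : G ≅ H) where
  private
    σ : Fin n ↔ Fin n
    σ = proj₁ G≅H

  degree-≅ : ∀ u → degree G u ≡ degree H (Inverse.to σ u)
  degree-≅ u = trans (sumFin-cong {n} (λ v → cong b2n (proj₂ G≅H u v))) (sumFin-permute σ (b2n ∘ adj H (Inverse.to σ u)))

  M₁-≅ : M₁ G ≡ M₁ H
  M₁-≅ = begin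
    M₁ G                                                            ≡⟨ M₁≡sum-degree² G ⟩
    sumFin (λ u → degree G u * degree G u)                          ≡⟨ sumFin-cong {n} (λ u → cong₂ _*_ (degree-≅ u) (degree-≅ u)) ⟩
    sumFin (λ u → degree H (Inverse.to σ u) * degree H (Inverse.to σ u)) ≡⟨ sumFin-permute σ (λ w → degree H w * degree H w) ⟩
    sumFin (λ w → degree H w * degree H w)                          ≡⟨ M₁≡sum-degree² H ⟨
    M₁ H                                                            ∎
    where open ≡-Reasoning

-- Recognising T_{2m,m} from the degrees along a perfect matching

module RecogniseT (m′ : ℕ) {G : Graph (2 * suc m′)} {p q : ℕ → Fin (2 * suc m′)} (M : PerfectMatching G (suc m′) p q)
  (q-leaf    : ∀ k → k < suc m′ → degree G (q k) ≡ 1)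
  (p₀-degree : degree G (p 0) ≡ suc m′)
  (p-degree  : ∀ k → 1 ≤ k → k < suc m′ → degree G (p k) ≡ 2) where

  open PerfectMatching M
  open PerfectMatchingSum M using (enumerate; enumerate-injective; sumFin-matched)

  m : ℕ
  m = suc m′

  leaf-neighbour : ∀ {k v} → k < m → adj G (q k) v ≡ true → v ≡ p k
  leaf-neighbour k<m qv = degree≡1⇒unique-neighbour G (q-leaf _ k<m) (adj-sym G (edge _ k<m)) qv

  centre-leaf : ∀ {k} → 1 ≤ k → k < m → adj G (p 0) (q k) ≡ false
  centre-leaf 1≤k k<m = ¬Tᵇ⇒≡false λ adjacent →
    >⇒≢ 1≤k (sym (p-injective 0 _ z<s k<m (leaf-neighbour k<m (adj-sym G (Tᵇ⇒≡true adjacent)))))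

  -- p 0 has degree m, is matched to q 0 and sees no other q k, so it must see every p k.
  centre-inner : ∀ k → 1 ≤ k → k < m → adj G (p 0) (p k) ≡ true
  centre-inner (suc k) _ (s<s k<m′) = b2n≡1⇒≡true
    (sumBelow≡n⇒all≡1 m′ (λ j → f (p (suc j))) (λ j _ → b2n≤1 _) inner-count k k<m′)
    where
    f : Fin (2 * m) → ℕ
    f = b2n ∘ adj G (p 0)
    inner-count : sumBelow m′ (λ j → f (p (suc j))) ≡ m′
    inner-count = suc-injective (begin
      suc (sumBelow m′ (λ j → f (p (suc j))))
        ≡⟨ cong suc (sumBelow-cong m′ (λ j j< → trans (sym (+-identityʳ _)) (cong (f (p (suc j)) +_)
             (sym (cong b2n (centre-leaf (s≤s z≤n) (s<s j<))))))) ⟩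
      suc (sumBelow m′ (λ j → f (p (suc j)) + f (q (suc j))))
        ≡⟨ cong₂ (λ x y → b2n x + b2n y + sumBelow m′ (λ j → f (p (suc j)) + f (q (suc j)))) (irrefl G (p 0)) (edge 0 z<s) ⟨
      sumBelow m (λ j → f (p j) + f (q j))
        ≡⟨ sumFin-matched f ⟨
      degree G (p 0)
        ≡⟨ p₀-degree ⟩
      m  ∎)
      where open ≡-Reasoning

  vertexOf : ∀ {a} → Label m a → Fin (2 * m)
  vertexOf (centre _)      = p 0
  vertexOf (inner k _ _ _) = p k
  vertexOf (tip _)         = q 0
  vertexOf (outer k _ _ _) = q k

  listing-label : ∀ {a} (la : Label m a) → listing m p q a ≡ vertexOf la
  listing-label (centre refl)        = listing-< m p q 0 z<s
  listing-label (inner k _ k<m refl) = listing-< m p q k k<m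
  listing-label (tip refl)           = subst (λ a → listing m p q a ≡ q 0) (+-identityʳ m) (listing-+ m p q 0)
  listing-label (outer k _ _ refl)   = listing-+ m p q k

  adj-vertexOf : ∀ {a b} (la : Label m a) (lb : Label m b) → adj G (vertexOf la) (vertexOf lb) ≡ labelAdj la lb
  adj-vertexOf (centre _)        (centre _)          = irrefl G (p 0)
  adj-vertexOf (centre _)        (inner k 1≤k k<m _) = centre-inner k 1≤k k<m
  adj-vertexOf (centre _)        (tip _)             = edge 0 z<s
  adj-vertexOf (centre _)        (outer k 1≤k k<m _) = centre-leaf 1≤k k<m
  adj-vertexOf (inner k 1≤k k<m _) (inner l 1≤l l<m _) = Boolₚ.¬-not λ pk~pl →
    [ p≢q l k l<m k<m , (λ pl≡p0 → >⇒≢ 1≤l (p-injective l 0 l<m z<s pl≡p0)) ]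
      (degree≡2⇒two-neighbours G (p-degree k 1≤k k<m) (edge k k<m) (adj-sym G (centre-inner k 1≤k k<m))
        (λ qk≡p0 → p≢q 0 k z<s k<m (sym qk≡p0)) pk~pl)
  adj-vertexOf (inner k 1≤k k<m _) (tip _) = Boolₚ.¬-not λ pk~q0 →
    >⇒≢ 1≤k (p-injective k 0 k<m z<s (leaf-neighbour z<s (adj-sym G pk~q0)))
  adj-vertexOf (inner k _ k<m _) (outer l _ l<m _) with k ≟ l
  ... | yes refl rewrite Tᵇ⇒≡true (≡⇒≡ᵇ k k refl) = edge k k<m
  ... | no k≢l   rewrite ¬Tᵇ⇒≡false (k≢l ∘ ≡ᵇ⇒≡ k l) = Boolₚ.¬-not λ pk~ql →
    k≢l (p-injective k l k<m l<m (leaf-neighbour l<m (adj-sym G pk~ql)))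
  adj-vertexOf (tip _) (tip _) = irrefl G (q 0)
  adj-vertexOf (tip _) (outer k _ k<m _) = Boolₚ.¬-not λ q0~qk → p≢q 0 k z<s k<m (sym (leaf-neighbour z<s q0~qk))
  adj-vertexOf (outer k _ k<m _) (outer l _ l<m _) = Boolₚ.¬-not λ qk~ql → p≢q k l k<m l<m (sym (leaf-neighbour k<m qk~ql))
  adj-vertexOf la@(inner _ _ _ _) lb@(centre _)      = trans (Graph.sym G _ _) (trans (adj-vertexOf lb la) (labelAdj-sym lb la))
  adj-vertexOf la@(tip _)         lb@(centre _)      = trans (Graph.sym G _ _) (trans (adj-vertexOf lb la) (labelAdj-sym lb la))
  adj-vertexOf la@(tip _)         lb@(inner _ _ _ _) = trans (Graph.sym G _ _) (trans (adj-vertexOf lb la) (labelAdj-sym lb la))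
  adj-vertexOf la@(outer _ _ _ _) lb@(centre _)      = trans (Graph.sym G _ _) (trans (adj-vertexOf lb la) (labelAdj-sym lb la))
  adj-vertexOf la@(outer _ _ _ _) lb@(inner _ _ _ _) = trans (Graph.sym G _ _) (trans (adj-vertexOf lb la) (labelAdj-sym lb la))
  adj-vertexOf la@(outer _ _ _ _) lb@(tip _)         = trans (Graph.sym G _ _) (trans (adj-vertexOf lb la) (labelAdj-sym lb la))

  adj-enumerate : ∀ x y → adj G (enumerate x) (enumerate y) ≡ adj (T (2 * m) m) x y
  adj-enumerate x y = begin
    adj G (enumerate x) (enumerate y)     ≡⟨ cong₂ (adj G) (listing-label lx) (listing-label ly) ⟩
    adj G (vertexOf lx) (vertexOf ly)     ≡⟨ adj-vertexOf lx ly ⟩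
    labelAdj lx ly                        ≡⟨ TadjSym≡labelAdj (s≤s z≤n) lx ly ⟨
    TadjSym (2 * m) m (toℕ x) (toℕ y)     ∎
    where
    open ≡-Reasoning
    lx : Label m (toℕ x)
    lx = label m (toℕ x) (toℕ<n x)
    ly : Label m (toℕ y)
    ly = label m (toℕ y) (toℕ<n y)

  ≅T : G ≅ T (2 * m) m
  ≅T = σ , λ u v → trans (sym (cong₂ (adj G) (enumerate∘σ u) (enumerate∘σ v))) (adj-enumerate (Inverse.to σ u) (Inverse.to σ v))
    where
    σ : Fin (2 * m) ↔ Fin (2 * m)
    σ = ↔-sym (injective⇒↔ enumerate enumerate-injective)
    enumerate∘σ : ∀ u → enumerate (Inverse.to σ u) ≡ u
    enumerate∘σ = Inverse.strictlyInverseˡ (injective⇒↔ enumerate enumerate-injective)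

-- Orient every pair so that q k is its leaf, then move the pair of degree sum m + 1 to index 0.
extremal⇒≅T : ∀ m′ {G : Graph (2 * suc m′)} {p q} → PerfectMatching G (suc m′) p q →
              Extremal (suc m′) (degree G ∘ p) (degree G ∘ q) → G ≅ T (2 * suc m′) (suc m′)
extremal⇒≅T m′ {G} {p} {q} M (i , i<m , has-leaf , centre-pair , other-pairs) =
  RecogniseT.≅T m′ M″ (λ k k<m → q′-leaf (swap₀ i k) (swap₀-< i<m k k<m)) p″₀-degree p″-degree
  where
  m : ℕ
  m = suc m′
  a b : ℕ → ℕ
  a = degree G ∘ p
  b = degree G ∘ q

  p-leaf : ℕ → Bool
  p-leaf k = a k ≡ᵇ 1

  p′ q′ : ℕ → Fin (2 * m)
  p′ = orient p-leaf p q
  q′ = orient p-leaf q p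

  M″ : PerfectMatching G m (p′ ∘ swap₀ i) (q′ ∘ swap₀ i)
  M″ = PerfectMatching-reindex (PerfectMatching-orient M p-leaf) (swap₀ i) (swap₀-< i<m) (λ k _ → swap₀-involutive i k)

  q′-leaf : ∀ k → k < m → degree G (q′ k) ≡ 1
  q′-leaf k k<m with p-leaf k in leaf? | has-leaf k k<m
  ... | true  | _         = ≡ᵇ⇒≡ (a k) 1 (subst Tᵇ (sym leaf?) tt)
  ... | false | inj₂ b≡1  = b≡1
  ... | false | inj₁ a≡1  = ⊥-elim (true≢false (trans (sym (Tᵇ⇒≡true (≡⇒≡ᵇ (a k) 1 a≡1))) leaf?))

  p′+1 : ∀ k → k < m → degree G (p′ k) + 1 ≡ a k + b k
  p′+1 k k<m with p-leaf k in leaf? | q′-leaf k k<m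
  ... | true  | a≡1 = trans (+-comm (b k) 1) (cong (_+ b k) (sym a≡1))
  ... | false | b≡1 = cong (a k +_) (sym b≡1)

  p″₀-degree : degree G (p′ (swap₀ i 0)) ≡ m
  p″₀-degree = suc-injective (trans (+-comm 1 _) (trans (p′+1 i i<m) centre-pair))

  p″-degree : ∀ k → 1 ≤ k → k < m → degree G (p′ (swap₀ i k)) ≡ 2
  p″-degree k 1≤k k<m = suc-injective (trans (+-comm 1 _) (trans (p′+1 (swap₀ i k) j<m)
    (other-pairs (swap₀ i k) j<m (>⇒≢ 1≤k ∘ swap₀≡⇒ i k))))
    where
    j<m : swap₀ i k < m
    j<m = swap₀-< i<m k k<m

-- Trees with a perfect matching

module _ {m : ℕ} {G : Graph (2 * m)} {p q : ℕ → Fin (2 * m)} (M : PerfectMatching G m p q) where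
  open PerfectMatchingSum M using (sumFin-matched)

  M₁≡pair-squares : M₁ G ≡ sumBelow m (λ k → degree G (p k) * degree G (p k) + degree G (q k) * degree G (q k))
  M₁≡pair-squares = trans (M₁≡sum-degree² G) (sumFin-matched (λ v → degree G v * degree G v))

  acyclic⇒pair-handshake : 1 ≤ m → Acyclic G → sumBelow m (λ k → degree G (p k) + degree G (q k)) + 2 ≤ 2 * (2 * m)
  acyclic⇒pair-handshake (s≤s {n = m′} z≤n) acyclic =
    subst (λ s → s + 2 ≤ 2 * (2 * m)) (sumFin-matched (degree G)) (acyclic⇒sum-degree+2≤ (m′ + suc (m′ + 0)) G acyclic)

M₁-slack : ∀ m′ {G : Graph (2 * suc m′)} → IsTree G → ∀ {p q} → PerfectMatching G (suc m′) p q →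
  Σ ℕ λ slack → (M₁ G + 4 + slack ≡ suc m′ * suc m′ + 5 * suc m′)
              × (slack ≡ 0 → Extremal (suc m′) (degree G ∘ p) (degree G ∘ q))
-- For m = 1 the tree is a single edge, where a + b ≥ 3 fails; the handshake bound alone gives a = b = 1.
M₁-slack zero {G} (_ , acyclic) {p} {q} M = 0 , M₁+4≡6 , λ _ → 0 , z<s
  , (λ { zero _ → inj₁ a≡1 ; (suc _) (s<s ()) }) , cong₂ _+_ a≡1 b≡1 , λ { zero _ 0≢0 → ⊥-elim (0≢0 refl) ; (suc _) (s<s ()) _ }
  where
  a b : ℕ
  a = degree G (p 0)
  b = degree G (q 0)
  a+b≤2 : a + b ≤ 2
  a+b≤2 = +-cancelʳ-≤ 2 _ _ (subst (λ s → s + 2 ≤ 4) (+-identityʳ (a + b)) (acyclic⇒pair-handshake M (s≤s z≤n) acyclic))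
  a≡1 : a ≡ 1
  a≡1 = ≤-antisym (+-cancelʳ-≤ 1 a 1 (≤-trans (+-monoʳ-≤ a (q-degree≥1 M 0 z<s)) a+b≤2)) (p-degree≥1 M 0 z<s)
  b≡1 : b ≡ 1
  b≡1 = ≤-antisym (+-cancelˡ-≤ 1 b 1 (≤-trans (+-monoˡ-≤ b (p-degree≥1 M 0 z<s)) a+b≤2)) (q-degree≥1 M 0 z<s)
  M₁+4≡6 : M₁ G + 4 + 0 ≡ 6
  M₁+4≡6 = trans (cong (λ s → s + 4 + 0) (M₁≡pair-squares M)) (cong₂ (λ x y → x * x + y * y + 0 + 4 + 0) a≡1 b≡1)
M₁-slack (suc m″) {G} (connected , acyclic) {p} {q} M = slack , trans (cong (λ s → s + 4 + slack) (M₁≡pair-squares M)) squares+slack , slack≡0⇒extremal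
  where
  profile : DegreeProfile (suc (suc m″)) (degree G ∘ p) (degree G ∘ q)
  profile = record
    { a≥1       = p-degree≥1 M
    ; b≥1       = q-degree≥1 M
    ; a+b≥3     = connected⇒pair-degree≥3 M connected (s≤s (s≤s z≤n))
    ; handshake = acyclic⇒pair-handshake M (s≤s z≤n) acyclic
    }
  open DegreeProfileBound profile

perfectly-matched-tree : ∀ m′ {G : Graph (2 * suc m′)} → IsTree G → ∀ {p q} → PerfectMatching G (suc m′) p q →
  (M₁ G + 4 ≤ suc m′ * suc m′ + 5 * suc m′) × ((M₁ G + 4 ≡ suc m′ * suc m′ + 5 * suc m′) ⇔ (G ≅ T (2 * suc m′) (suc m′)))
perfectly-matched-tree m′ {G} tree M with M₁-slack m′ tree M
... | slack , identity , tight = subst (M₁ G + 4 ≤_) identity (m≤m+n (M₁ G + 4) slack) , mk⇔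
  (λ M₁+4≡ → extremal⇒≅T m′ M (tight (+-cancelˡ-≡ (M₁ G + 4) slack 0 (trans identity (sym (trans (+-identityʳ _) M₁+4≡))))))
  (λ G≅T → trans (cong (_+ 4) (M₁-≅ {G = G} {H = T (2 * suc m′) (suc m′)} G≅T)) (DegreesOfT.M₁-T m′))

lemma7 : (m : ℕ) → 1 ≤ m → (G : Graph (2 * m)) → IsTree G → MatchingNumber G m →
    (M₁ G + 4 ≤ m * m + 5 * m) × ((M₁ G + 4 ≡ m * m + 5 * m) ⇔ (G ≅ T (2 * m) m))
lemma7 (suc m′) _ G tree ((M , M-matching , |M|≡m) , _) =
  perfectly-matched-tree m′ tree (matching⇒PerfectMatching G (Fin.zero , Fin.zero) M M-matching |M|≡m)
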